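{- Let $D>1$ be squarefree, $u=A+B\sqrt{D}\in\mathcal{S}_D$, $C=C(u)$, $d=-27C^2D$, and let $[a,2b,c]$ be a primitive form with $a>0$ and $b^2-ac=d$. Let $x,y$ be integers, $f=ax^2+2bxy+cy^2$, and assume $\gcd(af,\,3N(u)Dy)=1$. Let $A_2=BD^2$, $B_2=AD$, let $T$ be the largest integer cube dividing $\gcd(A_2,B_2)$, and let $u_2=(A_2+B_2\sqrt{D})/T$. Then $R(u)=R(u_2)$, where for $v=A'+B'\sqrt{D}\in\mathcal{S}_D$ with $3\nmid a$, $$R(v)=\left(\frac{9A'-(B'/C(v))\,b\,(1+2\omega)}{a}\right)_3 .$$
   Context: For squarefree $D>1$, let $\mathcal{O}$ be the ring of integers of $\mathbb{Q}(\sqrt{D})$. The set $\mathcal{S}_D$ consists of those $u=A+B\sqrt{D}$ with $A,B\in\mathbb{Z}$ such that the norm $N(u)=A^2-B^2D$ is the cube of an integer, $u$ is not a cube in $\mathcal{O}$, and $\gcd(A,B)$ is not divisible by the cube of any prime. For $u\in\mathcal{S}_D$, $C(u)$ is the product of the distinct odd primes that divide $\gcd(A,B)$ but do not divide $D$. The element $u_2$ defined in the claim has integer coefficients $A_2/T$, $B_2/T$, lies in $\mathcal{S}_D$, and satisfies $C(u_2)=C(u)$. Let $\omega=(-1+i\sqrt{3})/2$. For $\alpha\in\mathbb{Z}[\omega]$ and a prime $\pi$ of $\mathbb{Z}[\omega]$ not dividing $3$, $(\alpha/\pi)_3\in\{0,1,\omega,\omega^2\}$ is the cubic residue symbol, $(\alpha/\pi)_3\equiv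 \alpha^{(N\pi-1)/3}\pmod{\pi}$; for a positive rational integer $n$ coprime to $3$, $(\alpha/n)_3$ is defined multiplicatively via the factorization of $n$ into primes of $\mathbb{Z}[\omega]$. -}

module Defs where

open import Data.Nat as ℕ using (ℕ; zero; suc)
import Data.Nat.Divisibility as ℕD
open import Data.Nat.Primality using (Prime; prime?)
open import Data.Nat.GCD as ℕG using ()
open import Data.Integer as ℤ using (ℤ; +_; -_; _+_; _-_; _*_; ∣_∣)
open import Data.Integer.Divisibility using (_∣_)
open import Data.Integer.GCD renaming (gcd to ℤgcd)
open import Data.Integer.DivMod using (_/ℕ_)
open import Data.List using (List; []; _∷_; filter; upTo)
open import Data.Nat.ListAction using (product)
open import Data.Product using (Σ; ∃; _×_; _,_)
open import Data.Sum using (_⊎_)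
open import Relation.Nullary using (¬_)
open import Relation.Nullary.Decidable using (_×-dec_; ¬?)
open import Relation.Binary.PropositionalEquality using (_≡_)

Squarefree : ℕ → Set
Squarefree n = ∀ (m : ℕ) → m ℕ.* m ℕD.∣ n → m ≡ 1

-- Quadratic field Q(√D): the element A + B√D is the pair (A , B).
-- Norm N(A + B√D) = A² − B² D.
normQ : ℕ → ℤ → ℤ → ℤ
normQ D A B = A * A - B * B * + D

-- (x + y√D)/2 lies in the ring of integers O of Q(√D), D squarefree > 1:
-- if D ≡ 1 mod 4, iff x ≡ y mod 2; otherwise iff x and y are both even.
InO : ℕ → ℤ → ℤ → Set
InO D x y = (D ℕ.% 4 ≡ 1 × (+ 2) ∣ (x - y))
          ⊎ ((¬ D ℕ.% 4 ≡ 1) × (((+ 2) ∣ x) × ((+ 2) ∣ y)))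

-- A + B√D is a cube in O: A + B√D = ((x + y√D)/2)³ with (x+y√D)/2 ∈ O,
-- i.e. 8A = x³ + 3xy²D and 8B = 3x²y + y³D.
CubeInO : ℕ → ℤ → ℤ → Set
CubeInO D A B = Σ ℤ λ x → Σ ℤ λ y → InO D x y
  × (+ 8 * A ≡ x * x * x + + 3 * x * y * y * + D)
  × (+ 8 * B ≡ + 3 * x * x * y + y * y * y * + D)

InS : ℕ → ℤ → ℤ → Set
InS D A B =
  (Σ ℤ λ n → normQ D A B ≡ n * n * n)
  × (¬ CubeInO D A B)
  × (∀ (p : ℕ) → Prime p → ¬ ((+ (p ℕ.* p ℕ.* p)) ∣ (ℤgcd A B)))

CP : ℕ → ℕ → ℕ → Set
CP D g p = Prime p × (p ℕ.% 2 ≡ 1) × (p ℕD.∣ g) × ¬ (p ℕD.∣ D)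

Cof : ℕ → ℤ → ℤ → ℕ
Cof D A B = product (filter (λ p → prime? p ×-dec ((p ℕ.% 2) ℕ.≟ 1)
                                 ×-dec (p ℕD.∣? g) ×-dec ¬? (p ℕD.∣? D))
                            (upTo (suc g)))
  where g = ℕG.gcd ∣ A ∣ ∣ B ∣

-- exact integer division by a natural number (used for B'/C(v); C(v) ≥ 1)
_/ℕ'_ : ℤ → ℕ → ℤ
a /ℕ' zero = + 0
a /ℕ' suc n = a /ℕ suc n

-- Eisenstein integers Z[ω], ω = (−1 + i√3)/2, ω² = −1 − ω.
-- The element x + yω is  mkE x y.
record ℤω : Set where
  constructor mkE
  field re : ℤ
        im : ℤ
open ℤω public

_+ω_ : ℤω → ℤω → ℤω
mkE a b +ω mkE c d = mkE (a + c) (b + d)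

_-ω_ : ℤω → ℤω → ℤω
mkE a b -ω mkE c d = mkE (a - c) (b - d)

_*ω_ : ℤω → ℤω → ℤω
mkE a b *ω mkE c d = mkE (a * c - b * d) (a * d + b * c - b * d)

oneω : ℤω
oneω = mkE (+ 1) (+ 0)

ω : ℤω
ω = mkE (+ 0) (+ 1)

fromℤ : ℤ → ℤω
fromℤ n = mkE n (+ 0)

_^ω_ : ℤω → ℕ → ℤω
α ^ω zero = oneω
α ^ω suc k = α *ω (α ^ω k)

Nω : ℤω → ℕ
Nω (mkE a b) = ∣ a * a - a * b + b * b ∣

_∣ω_ : ℤω → ℤω → Set
π ∣ω α = Σ ℤω λ γ → α ≡ π *ω γ

Unitω : ℤω → Set
Unitω e = Nω e ≡ 1

Primeω : ℤω → Set
Primeω π = (¬ π ≡ fromℤ (+ 0)) × (¬ Unitω π)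
  × (∀ x y → π ∣ω (x *ω y) → (π ∣ω x) ⊎ (π ∣ω y))

data Cub : Set where
  c0 c1 cω cω² : Cub

⟦_⟧c : Cub → ℤω
⟦ c0 ⟧c = fromℤ (+ 0)
⟦ c1 ⟧c = oneω
⟦ cω ⟧c = ω
⟦ cω² ⟧c = ω *ω ω

CubicSymP : ℤω → ℤω → Cub → Set
CubicSymP α π ζ =
  π ∣ω ((α ^ω ((Nω π ℕ.∸ 1) ℕ./ 3)) -ω ⟦ ζ ⟧c)

prodω : List ℤω → ℤω
prodω [] = oneω
prodω (x ∷ xs) = x *ω prodω xs

data Factored (α : ℤω) : List ℤω → List Cub → Set where
  [] : Factored α [] []
  _∷_ : ∀ {π ζ πs ζs} → (Primeω π × ¬ (π ∣ω fromℤ (+ 3)) × CubicSymP α π ζ)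
        → Factored α πs ζs → Factored α (π ∷ πs) (ζ ∷ ζs)

prodC : List Cub → ℤω
prodC [] = oneω
prodC (ζ ∷ ζs) = ⟦ ζ ⟧c *ω prodC ζs

-- (α/n)_3 = ζ for a positive rational integer n coprime to 3, defined
-- multiplicatively through the factorisation n = unit · π₁ ⋯ π_k in Z[ω].
CubicSym : ℤω → ℕ → Cub → Set
CubicSym α n ζ = Σ (List ℤω) λ πs → Σ (List Cub) λ ζs →
  Factored α πs ζs
  × (Σ ℤω λ e → Unitω e × fromℤ (+ n) ≡ e *ω prodω πs)
  × (⟦ ζ ⟧c ≡ prodC ζs)

Rarg : ℕ → ℤ → ℤ → ℤ → ℤω
Rarg D A' B' b = fromℤ (+ 9 * A') -ω (fromℤ ((B' /ℕ' Cof D A' B') * b) *ω mkE (+ 1) (+ 2))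

R : ℕ → ℤ → ℤ → ℤ → ℕ → Cub → Set
R D A' B' b a ζ = CubicSym (Rarg D A' B' b) a ζ

LargestCube : ℤ → ℤ → ℕ → Set
LargestCube A₂ B₂ t = ((+ (t ℕ.* t ℕ.* t)) ∣ (ℤgcd A₂ B₂))
  × (∀ s → (+ (s ℕ.* s ℕ.* s)) ∣ (ℤgcd A₂ B₂) → s ℕ.≤ t)

-- Write √-3 = 1 + 2ω, C = C(u), K = 27C²D and T = t³, so that A₂T = BD² and B₂T = AD.  The
-- arguments α = 9A − (B/C)b√-3 and α₂ = 9A₂ − (B₂/C)b√-3 of R(u) and R(u₂) (note C(u₂) = C(u): a
-- prime p ∤ D dividing t would put p³ into the cube-free gcd(A, B)) satisfy
--     (b√-3)³ α + (9Ct)³ α₂ = (b² + K)(−9(B/C)(b² − K) − 27Ab√-3),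
-- and b² + K = ac, so (b√-3)³ α ≡ (−9Ct)³ α₂ modulo a.  For a prime π ∤ 3 of ℤ[ω] dividing a, the
-- coprimality hypothesis makes b√-3 and 9Ct prime to π.  By Fermat's little theorem in ℤ[ω]/π
-- (proved with the Frobenius congruence) cubes prime to π have trivial cubic residue symbol, so
-- (α/π)₃ = (α₂/π)₃; multiplying over the prime factorisation of a gives R(u) = R(u₂).

module Submission where

open import Defs
open import Data.Nat as ℕ using (ℕ)
open import Data.Integer as ℤ using (ℤ; +_; _+_; _*_; _-_; _<_)
open import Data.Integer.Divisibility using (_∣_)
open import Data.Integer.GCD renaming (gcd to ℤgcd)
open import Data.Nat.Primality using (Prime)
open import Data.Product using (_×_)
open import Relation.Nullary using (¬_)
open import Relation.Binary.PropositionalEquality using (_≡_)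

open import Algebra.Bundles using (CommutativeRing; CommutativeSemiring)
import Data.Fin.Properties as FinP
open import Data.Empty using (⊥-elim)
open import Data.Fin using (Fin; zero; suc; toℕ; fromℕ; inject₁)
open import Data.Integer as ℤ using (-[1+_]; -_; ∣_∣)
open import Data.Integer.DivMod using (a≡a%ℕn+[a/ℕn]*n)
import Data.Integer.Divisibility.Signed as ℤS
import Data.Integer.Properties as ℤP
import Data.Integer.Tactic.RingSolver as ℤ-Solver
open import Data.List using ([]; _∷_; filter; upTo; _++_; [_])
open import Data.List.Membership.Propositional.Properties using (∈-filter⁻)
import Data.List.Properties as ListP
open import Data.List.Relation.Unary.All as All using (All)
open import Data.List.Relation.Unary.Unique.Propositional as Unique using (Unique)
open import Data.List.Relation.Unary.Unique.Propositional.Properties using (upTo⁺; filter⁺)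
open import Data.Maybe using (Maybe; just; nothing)
open import Data.Nat as ℕ using (zero; suc; _!)
open import Data.Nat.Combinatorics using (nCk≡n!/k![n-k]!; k![n∸k]!∣n!; nCn≡1) renaming (_C_ to _choose_)
open import Data.Nat.Coprimality using (Coprime; coprime-divisor)
open import Data.Nat.Divisibility as ℕD using (divides)
open import Data.Nat.DivMod using (m%n<n; m/n*n≡m; m*[n/m]≡n; m≡m%n+[m/n]*n; %-distribˡ-*; [m+kn]%n≡m%n)
import Data.Nat.GCD as ℕG
open import Data.Nat.ListAction using (product)
open import Data.Nat.Primality using (prime; prime?; euclidsLemma; prime⇒irreducible; prime⇒nonZero; productOfPrimes≥1; ¬prime[1])
open import Data.Nat.Primality.Factorisation using (factorise; PrimeFactorisation; factorisationHasAllPrimeFactors)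
import Data.Nat.Properties as ℕP
open import Data.Product using (Σ; _,_; proj₁; proj₂)
open import Data.Sum using (_⊎_; inj₁; inj₂; [_,_]′; reduce)
open import Function using (case_of_)
open import Relation.Binary.Bundles using (Setoid)
open import Relation.Binary.PropositionalEquality hiding ([_])
import Relation.Binary.Reasoning.Setoid
open import Relation.Binary.Structures using (IsEquivalence)
open import Relation.Nullary using (yes; no)
open import Relation.Nullary.Decidable using (_×-dec_; ¬?; from-yes)
open import Relation.Unary using (Decidable)
import Tactic.RingSolver.Core.AlmostCommutativeRing as ACR
open import Tactic.RingSolver using (solve-∀)
open import Algebra.Structures {A = ℤω} _≡_ using (IsCommutativeRing)

prime∤m∤n⇒∤m*n : ∀ {p m n} → Prime p → ¬ p ℕD.∣ m → ¬ p ℕD.∣ n → ¬ p ℕD.∣ m ℕ.* n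
prime∤m∤n⇒∤m*n {m = m} {n} p-prime p∤m p∤n p∣mn with euclidsLemma m n p-prime p∣mn
... | inj₁ p∣m = p∤m p∣m
... | inj₂ p∣n = p∤n p∣n

prime∣m*n∤n⇒∣m : ∀ {p m n} → Prime p → ¬ p ℕD.∣ n → p ℕD.∣ m ℕ.* n → p ℕD.∣ m
prime∣m*n∤n⇒∣m {m = m} {n} p-prime p∤n p∣mn with euclidsLemma m n p-prime p∣mn
... | inj₁ p∣m = p∣m
... | inj₂ p∣n = ⊥-elim (p∤n p∣n)

prime^k∣m*n⇒∣m : ∀ {p n} → Prime p → ¬ p ℕD.∣ n → ∀ k {m} → p ℕ.^ k ℕD.∣ m ℕ.* n → p ℕ.^ k ℕD.∣ m
prime^k∣m*n⇒∣m p-prime p∤n zero _ = ℕD.1∣ _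
prime^k∣m*n⇒∣m {p} {n} p-prime p∤n (suc k) {m} p^[1+k]∣mn
  with divides m′ refl ← prime∣m*n∤n⇒∣m {m = m} p-prime p∤n (ℕD.∣-trans (ℕD.m∣m*n (p ℕ.^ k)) p^[1+k]∣mn)
  = subst (p ℕ.^ suc k ℕD.∣_) (ℕP.*-comm p m′) (ℕD.*-monoʳ-∣ p
      (prime^k∣m*n⇒∣m p-prime p∤n k (ℕD.*-cancelˡ-∣ p ⦃ prime⇒nonZero p-prime ⦄
        (subst (p ℕ.* p ℕ.^ k ℕD.∣_) (rearrange m′ p n) p^[1+k]∣mn))))
  where
  rearrange : ∀ m′ p n → m′ ℕ.* p ℕ.* n ≡ p ℕ.* (m′ ℕ.* n)
  rearrange m′ p n = trans (cong (ℕ._* n) (ℕP.*-comm m′ p)) (ℕP.*-assoc p m′ n)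

prime∣m^[1+n]⇒∣m : ∀ {q m} → Prime q → ∀ n → q ℕD.∣ m ℕ.^ suc n → q ℕD.∣ m
prime∣m^[1+n]⇒∣m {q} {m} q-prime zero q∣m^1 = subst (q ℕD.∣_) (ℕP.*-identityʳ m) q∣m^1
prime∣m^[1+n]⇒∣m {q} {m} q-prime (suc n) q∣m^[2+n] with euclidsLemma m (m ℕ.^ suc n) q-prime q∣m^[2+n]
... | inj₁ q∣m = q∣m
... | inj₂ q∣m^[1+n] = prime∣m^[1+n]⇒∣m q-prime n q∣m^[1+n]

∣p*p⇒≡1⊎≡p^[1+j] : ∀ {p d} → Prime p → d ℕD.∣ p ℕ.* p → d ≡ 1 ⊎ Σ ℕ λ j → d ≡ p ℕ.^ suc j
∣p*p⇒≡1⊎≡p^[1+j] {p} {d} p-prime d∣p*p with p ℕD.∣? d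
... | yes (divides e refl) with prime⇒irreducible p-prime (ℕD.*-cancelʳ-∣ {e} {p} p ⦃ prime⇒nonZero p-prime ⦄ d∣p*p)
...   | inj₁ refl = inj₂ (0 , trans (ℕP.*-identityˡ p) (sym (ℕP.*-identityʳ p)))
...   | inj₂ refl = inj₂ (1 , cong (p ℕ.*_) (sym (ℕP.*-identityʳ p)))
∣p*p⇒≡1⊎≡p^[1+j] {p} {d} p-prime d∣p*p | no p∤d with prime⇒irreducible p-prime (coprime-divisor coprime d∣p*p)
  where
  coprime : Coprime d p
  coprime (e∣d , e∣p) with prime⇒irreducible p-prime e∣p
  ... | inj₁ e≡1 = e≡1
  ... | inj₂ refl = ⊥-elim (p∤d e∣d)
... | inj₁ d≡1 = inj₁ d≡1
... | inj₂ d≡p = inj₂ (0 , trans d≡p (sym (ℕP.*-identityʳ p)))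

cube≡^3 : ∀ p → p ℕ.* p ℕ.* p ≡ p ℕ.^ 3
cube≡^3 p = trans (ℕP.*-assoc p p p) (cong (λ z → p ℕ.* (p ℕ.* z)) (sym (ℕP.*-identityʳ p)))

p∤m! : ∀ {p} → Prime p → ∀ m → m ℕ.< p → ¬ p ℕD.∣ m !
p∤m! p-prime zero _ p∣1 = ¬prime[1] (subst Prime (ℕD.∣1⇒≡1 p∣1) p-prime)
p∤m! p-prime (suc m) m<p =
  prime∤m∤n⇒∤m*n p-prime (λ p∣1+m → ℕP.<⇒≱ m<p (ℕD.∣⇒≤ p∣1+m)) (p∤m! p-prime m (ℕP.<-trans (ℕP.n<1+n m) m<p))

p∣p-choose-k : ∀ {p k} → Prime p → 0 ℕ.< k → k ℕ.< p → p ℕD.∣ p choose k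
p∣p-choose-k {p} {k} p-prime 0<k k<p = prime∣m*n∤n⇒∣m p-prime
  (prime∤m∤n⇒∤m*n p-prime (p∤m! p-prime k k<p) (p∤m! p-prime (p ℕ.∸ k) (ℕP.∸-monoʳ-< 0<k (ℕP.<⇒≤ k<p))))
  (subst (p ℕD.∣_) (sym [p-choose-k]*k![p-k]!≡p!) (p∣p! p (ℕP.<-trans 0<k k<p)))
  where
  [p-choose-k]*k![p-k]!≡p! : (p choose k) ℕ.* (k ! ℕ.* (p ℕ.∸ k) !) ≡ p !
  [p-choose-k]*k![p-k]!≡p! = trans (cong (ℕ._* (k ! ℕ.* (p ℕ.∸ k) !)) (nCk≡n!/k![n-k]! (ℕP.<⇒≤ k<p)))
                          (m/n*n≡m ⦃ ℕP._!*_!≢0 k (p ℕ.∸ k) ⦄ (k![n∸k]!∣n! (ℕP.<⇒≤ k<p)))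
  p∣p! : ∀ p → 0 ℕ.< p → p ℕD.∣ p !
  p∣p! (suc q) _ = ℕD.m∣m*n (q !)

prime∤product : ∀ {x xs} → Prime x → All Prime xs → All (x ≢_) xs → ¬ x ℕD.∣ product xs
prime∤product x-prime xs-prime x∉xs x∣Π = All.lookup x∉xs (factorisationHasAllPrimeFactors x-prime x∣Π xs-prime) refl

product-∣ : ∀ {g} xs → Unique xs → All (λ x → Prime x × x ℕD.∣ g) xs → product xs ℕD.∣ g
product-∣ [] _ _ = ℕD.1∣ _
product-∣ {g} (x ∷ xs) (x∉xs Unique.∷ xs-unique) ((x-prime , x∣g) All.∷ xs-divide)
  with divides q g≡q*Π ← product-∣ xs xs-unique xs-divide
  with divides r q≡r*x ← prime∣m*n∤n⇒∣m {m = q} x-prime (prime∤product x-prime (All.map proj₁ xs-divide) x∉xs)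
                                          (subst (x ℕD.∣_) g≡q*Π x∣g)
  = divides r (trans g≡q*Π (trans (cong (ℕ._* product xs) q≡r*x) (ℕP.*-assoc r x (product xs))))

square%3 : ∀ n → (n ℕ.* n) ℕ.% 3 ≡ 0 ⊎ (n ℕ.* n) ℕ.% 3 ≡ 1
square%3 n with n ℕ.% 3 | m%n<n n 3 | %-distribˡ-* n n 3
... | 0 | _ | n²%3≡0 = inj₁ n²%3≡0
... | 1 | _ | n²%3≡1 = inj₂ n²%3≡1
... | 2 | _ | n²%3≡1 = inj₂ n²%3≡1
... | suc (suc (suc _)) | ℕ.s≤s (ℕ.s≤s (ℕ.s≤s ())) | _

¬3∣n∧n%3≢2⇒n%3≡1 : ∀ n → ¬ 3 ℕD.∣ n → ¬ n ℕ.% 3 ≡ 2 → n ℕ.% 3 ≡ 1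
¬3∣n∧n%3≢2⇒n%3≡1 n 3∤n n%3≢2 with n ℕ.% 3 in n%3≡r | m%n<n n 3
... | 0 | _ = ⊥-elim (3∤n (ℕD.m%n≡0⇒n∣m n 3 n%3≡r))
... | 1 | _ = refl
... | 2 | _ = ⊥-elim (n%3≢2 refl)
... | suc (suc (suc _)) | ℕ.s≤s (ℕ.s≤s (ℕ.s≤s ()))

n%3≡1⇒1+[n∸1]≡n : ∀ n → n ℕ.% 3 ≡ 1 → suc (n ℕ.∸ 1) ≡ n
n%3≡1⇒1+[n∸1]≡n (suc n) _ = refl

n%3≡1⇒3*[[n∸1]/3]≡n∸1 : ∀ n → n ℕ.% 3 ≡ 1 → 3 ℕ.* ((n ℕ.∸ 1) ℕ./ 3) ≡ n ℕ.∸ 1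
n%3≡1⇒3*[[n∸1]/3]≡n∸1 n n%3≡1 = m*[n/m]≡n (divides (n ℕ./ 3)
  (cong (ℕ._∸ 1) (trans (m≡m%n+[m/n]*n n 3) (cong (ℕ._+ n ℕ./ 3 ℕ.* 3) n%3≡1))))

i*i≡∣i∣*∣i∣ : ∀ i → i * i ≡ + (∣ i ∣ ℕ.* ∣ i ∣)
i*i≡∣i∣*∣i∣ (+ n) = sym (ℤP.pos-* n n)
i*i≡∣i∣*∣i∣ -[1+ n ] = refl

x-y≡-z⇒x+z≡y : ∀ x y {z} → x - y ≡ - z → x + z ≡ y
x-y≡-z⇒x+z≡y x y {z} x-y≡-z = begin
  x + z                 ≡⟨ ℤ-Solver.solve (x ∷ y ∷ z ∷ []) ⟩
  (x - y) + z + y       ≡⟨ cong (λ w → w + z + y) x-y≡-z ⟩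
  - z + z + y           ≡⟨ ℤ-Solver.solve (y ∷ z ∷ []) ⟩
  y                     ∎
  where open ≡-Reasoning

0<i⇒∣i∣-nonZero : ∀ {i} → + 0 < i → ℕ.NonZero ∣ i ∣
0<i⇒∣i∣-nonZero {+ zero} (ℤ.+<+ ())
0<i⇒∣i∣-nonZero {+ suc _} _ = _

/ℕ'-exact : ∀ X n → n ≢ 0 → n ℕD.∣ ∣ X ∣ → X ≡ (X /ℕ' n) * + n
/ℕ'-exact X zero n≢0 _ = ⊥-elim (n≢0 refl)
/ℕ'-exact X (suc k) _ n∣X = trans (a≡a%ℕn+[a/ℕn]*n X (suc k))
  (trans (cong (λ r → + r + (X ℤ./ℕ suc k) * + suc k) (X%n≡0 X n∣X)) (ℤP.+-identityˡ _))
  where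
  X%n≡0 : ∀ X → suc k ℕD.∣ ∣ X ∣ → X ℤ.%ℕ suc k ≡ 0
  X%n≡0 (+ m) n∣m = ℕD.n∣m⇒m%n≡0 m (suc k) n∣m
  X%n≡0 -[1+ m ] n∣m rewrite ℕD.n∣m⇒m%n≡0 (suc m) (suc k) n∣m = refl

gcd≡1∧∣m⇒∤n : ∀ {p m n} → Prime p → ℤgcd m n ≡ + 1 → p ℕD.∣ ∣ m ∣ → ¬ p ℕD.∣ ∣ n ∣
gcd≡1∧∣m⇒∤n {p} {m} {n} p-prime gcd≡1 p∣m p∣n =
  ¬prime[1] (subst Prime (ℕD.∣1⇒≡1 (subst (λ g → p ℕD.∣ ∣ g ∣) gcd≡1 (gcd-greatest {m} {n} {+ p} p∣m p∣n))) p-prime)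

-- ℤ[ω] as a commutative ring

negω : ℤω → ℤω
negω (mkE a b) = mkE (- a) (- b)

0ω : ℤω
0ω = fromℤ (+ 0)

*ω-assoc : ∀ x y z → ((x *ω y) *ω z) ≡ (x *ω (y *ω z))
*ω-assoc (mkE a b) (mkE c d) (mkE e f) = cong₂ mkE (re-assoc a b c d e f) (im-assoc a b c d e f)
  where
  re-assoc : ∀ a b c d e f → (a * c - b * d) * e - (a * d + b * c - b * d) * f
                           ≡ a * (c * e - d * f) - b * (c * f + d * e - d * f)
  re-assoc = ℤ-Solver.solve-∀
  im-assoc : ∀ a b c d e f → (a * c - b * d) * f + (a * d + b * c - b * d) * e - (a * d + b * c - b * d) * f
                           ≡ a * (c * f + d * e - d * f) + b * (c * e - d * f) - b * (c * f + d * e - d * f)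
  im-assoc = ℤ-Solver.solve-∀

*ω-distribʳ-+ω : ∀ x y z → ((y +ω z) *ω x) ≡ ((y *ω x) +ω (z *ω x))
*ω-distribʳ-+ω (mkE a b) (mkE c d) (mkE e f) = cong₂ mkE (re-distrib a b c d e f) (im-distrib a b c d e f)
  where
  re-distrib : ∀ a b c d e f → (c + e) * a - (d + f) * b ≡ (c * a - d * b) + (e * a - f * b)
  re-distrib = ℤ-Solver.solve-∀
  im-distrib : ∀ a b c d e f → (c + e) * b + (d + f) * a - (d + f) * b
                             ≡ (c * b + d * a - d * b) + (e * b + f * a - f * b)
  im-distrib = ℤ-Solver.solve-∀

*ω-comm : ∀ x y → (x *ω y) ≡ (y *ω x)
*ω-comm (mkE a b) (mkE c d) = cong₂ mkE (ℤ-Solver.solve (a ∷ b ∷ c ∷ d ∷ [])) (ℤ-Solver.solve (a ∷ b ∷ c ∷ d ∷ []))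

*ω-identityˡ : ∀ x → (oneω *ω x) ≡ x
*ω-identityˡ (mkE a b) = cong₂ mkE (ℤ-Solver.solve (a ∷ b ∷ [])) (ℤ-Solver.solve (a ∷ b ∷ []))

ℤω-isCommutativeRing : IsCommutativeRing _+ω_ _*ω_ negω 0ω oneω
ℤω-isCommutativeRing = record
  { isRing = record
    { +-isAbelianGroup = record
      { isGroup = record
        { isMonoid = record
          { isSemigroup = record
            { isMagma = record { isEquivalence = isEquivalence ; ∙-cong = cong₂ _+ω_ }
            ; assoc = λ { (mkE a b) (mkE c d) (mkE e f) → cong₂ mkE (ℤP.+-assoc a c e) (ℤP.+-assoc b d f) } }
          ; identity = (λ { (mkE a b) → cong₂ mkE (ℤP.+-identityˡ a) (ℤP.+-identityˡ b) })
                     , (λ { (mkE a b) → cong₂ mkE (ℤP.+-identityʳ a) (ℤP.+-identityʳ b) }) }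
        ; inverse = (λ { (mkE a b) → cong₂ mkE (ℤP.+-inverseˡ a) (ℤP.+-inverseˡ b) })
                  , (λ { (mkE a b) → cong₂ mkE (ℤP.+-inverseʳ a) (ℤP.+-inverseʳ b) })
        ; ⁻¹-cong = cong negω }
      ; comm = λ { (mkE a b) (mkE c d) → cong₂ mkE (ℤP.+-comm a c) (ℤP.+-comm b d) } }
    ; *-cong = cong₂ _*ω_
    ; *-assoc = *ω-assoc
    ; *-identity = *ω-identityˡ , λ x → trans (*ω-comm x oneω) (*ω-identityˡ x)
    ; distrib = (λ x y z → trans (*ω-comm x (y +ω z))
                  (trans (*ω-distribʳ-+ω x y z) (cong₂ _+ω_ (*ω-comm y x) (*ω-comm z x))))
              , *ω-distribʳ-+ω }
  ; *-comm = *ω-comm }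

ℤω-commutativeRing : CommutativeRing _ _
ℤω-commutativeRing = record { isCommutativeRing = ℤω-isCommutativeRing }

-- The solver needs to recognise 0 to put normal forms in canonical shape.
ℤω-ring : ACR.AlmostCommutativeRing _ _
ℤω-ring = ACR.fromCommutativeRing ℤω-commutativeRing is-zero
  where
  is-zero : ∀ x → Maybe (0ω ≡ x)
  is-zero (mkE (+ 0) (+ 0)) = just refl
  is-zero _ = nothing

+ω-identityˡ : ∀ x → (0ω +ω x) ≡ x
+ω-identityˡ = solve-∀ ℤω-ring

+ω-identityʳ : ∀ x → (x +ω 0ω) ≡ x
+ω-identityʳ = solve-∀ ℤω-ring

+ω-comm : ∀ x y → (x +ω y) ≡ (y +ω x)
+ω-comm = solve-∀ ℤω-ring

*ω-identityʳ : ∀ x → (x *ω oneω) ≡ x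
*ω-identityʳ = solve-∀ ℤω-ring

*ω-zeroˡ : ∀ x → (0ω *ω x) ≡ 0ω
*ω-zeroˡ = solve-∀ ℤω-ring

negω-involutive : ∀ x → negω (negω x) ≡ x
negω-involutive = solve-∀ ℤω-ring

fromℤ-* : ∀ m n → fromℤ (m * n) ≡ (fromℤ m *ω fromℤ n)
fromℤ-* m n = cong₂ mkE (re-* m n) (im-* m n)
  where
  re-* : ∀ m n → m * n ≡ m * n - + 0 * + 0
  re-* = ℤ-Solver.solve-∀
  im-* : ∀ m n → + 0 ≡ m * + 0 + + 0 * n - + 0 * + 0
  im-* = ℤ-Solver.solve-∀

fromℤ-pos-* : ∀ m n → fromℤ (+ (m ℕ.* n)) ≡ (fromℤ (+ m) *ω fromℤ (+ n))
fromℤ-pos-* m n = trans (cong fromℤ (ℤP.pos-* m n)) (fromℤ-* (+ m) (+ n))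

-- In solver goals x -ω y is written x +ω negω y, to which it is definitionally equal.

∣ω-+ : ∀ {π x y} → π ∣ω x → π ∣ω y → π ∣ω (x +ω y)
∣ω-+ {π} (γ , refl) (γ′ , refl) = γ +ω γ′ , distrib π γ γ′
  where
  distrib : ∀ π γ γ′ → ((π *ω γ) +ω (π *ω γ′)) ≡ (π *ω (γ +ω γ′))
  distrib = solve-∀ ℤω-ring

∣ω-negω : ∀ {π x} → π ∣ω x → π ∣ω negω x
∣ω-negω {π} (γ , refl) = negω γ , neg-* π γ
  where
  neg-* : ∀ π γ → negω (π *ω γ) ≡ (π *ω negω γ)
  neg-* = solve-∀ ℤω-ring

∣ω-*ʳ : ∀ {π x} y → π ∣ω x → π ∣ω (x *ω y)
∣ω-*ʳ {π} y (γ , refl) = γ *ω y , *ω-assoc π γ y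

∣ω-*ˡ : ∀ {π y} x → π ∣ω y → π ∣ω (x *ω y)
∣ω-*ˡ {π} {y} x π∣y = subst (π ∣ω_) (*ω-comm y x) (∣ω-*ʳ {π} x π∣y)

∣ω-trans : ∀ {π ρ x} → π ∣ω ρ → ρ ∣ω x → π ∣ω x
∣ω-trans {π} π∣ρ (γ , refl) = ∣ω-*ʳ {π} γ π∣ρ

infix 4 _≈_mod_
record _≈_mod_ (x y π : ℤω) : Set where
  constructor ∣⇒≈
  field ≈⇒∣ : π ∣ω (x -ω y)
open _≈_mod_ public

module _ {π : ℤω} where

  ≈-refl : ∀ {x} → x ≈ x mod π
  ≈-refl {x} = ∣⇒≈ (0ω , x-x≡π*0 x π)
    where
    x-x≡π*0 : ∀ x π → (x +ω negω x) ≡ (π *ω 0ω)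
    x-x≡π*0 = solve-∀ ℤω-ring

  ≈-sym : ∀ {x y} → x ≈ y mod π → y ≈ x mod π
  ≈-sym {x} {y} (∣⇒≈ d) = ∣⇒≈ (subst (π ∣ω_) (neg-diff x y) (∣ω-negω {π} d))
    where
    neg-diff : ∀ x y → negω (x +ω negω y) ≡ (y +ω negω x)
    neg-diff = solve-∀ ℤω-ring

  ≈-trans : ∀ {x y z} → x ≈ y mod π → y ≈ z mod π → x ≈ z mod π
  ≈-trans {x} {y} {z} (∣⇒≈ d) (∣⇒≈ e) = ∣⇒≈ (subst (π ∣ω_) (diff-+ x y z) (∣ω-+ {π} d e))
    where
    diff-+ : ∀ x y z → ((x +ω negω y) +ω (y +ω negω z)) ≡ (x +ω negω z)
    diff-+ = solve-∀ ℤω-ring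

  ≡⇒≈ : ∀ {x y} → x ≡ y → x ≈ y mod π
  ≡⇒≈ refl = ≈-refl

  ≈-+ : ∀ {x y u v} → x ≈ y mod π → u ≈ v mod π → (x +ω u) ≈ (y +ω v) mod π
  ≈-+ {x} {y} {u} {v} (∣⇒≈ d) (∣⇒≈ e) = ∣⇒≈ (subst (π ∣ω_) (diff-+ x y u v) (∣ω-+ {π} d e))
    where
    diff-+ : ∀ x y u v → ((x +ω negω y) +ω (u +ω negω v)) ≡ ((x +ω u) +ω negω (y +ω v))
    diff-+ = solve-∀ ℤω-ring

  ≈-* : ∀ {x y u v} → x ≈ y mod π → u ≈ v mod π → (x *ω u) ≈ (y *ω v) mod π
  ≈-* {x} {y} {u} {v} (∣⇒≈ d) (∣⇒≈ e) = ∣⇒≈ (subst (π ∣ω_) (diff-* x y u v) (∣ω-+ {π} (∣ω-*ʳ {π} u d) (∣ω-*ˡ {π} y e)))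
    where
    diff-* : ∀ x y u v → (((x +ω negω y) *ω u) +ω (y *ω (u +ω negω v))) ≡ ((x *ω u) +ω negω (y *ω v))
    diff-* = solve-∀ ℤω-ring

  ≈-negω : ∀ {x y} → x ≈ y mod π → negω x ≈ negω y mod π
  ≈-negω {x} {y} (∣⇒≈ d) = ∣⇒≈ (subst (π ∣ω_) (neg-diff x y) (∣ω-negω {π} d))
    where
    neg-diff : ∀ x y → negω (x +ω negω y) ≡ (negω x +ω negω (negω y))
    neg-diff = solve-∀ ℤω-ring

  ≈-^ : ∀ {x y} n → x ≈ y mod π → (x ^ω n) ≈ (y ^ω n) mod π
  ≈-^ zero x≈y = ≈-refl
  ≈-^ (suc n) x≈y = ≈-* x≈y (≈-^ n x≈y)

  ∣⇒≈0 : ∀ {x} → π ∣ω x → x ≈ 0ω mod π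
  ∣⇒≈0 {x} d = ∣⇒≈ (subst (π ∣ω_) (x≡x-0 x) d)
    where
    x≡x-0 : ∀ x → x ≡ (x +ω negω 0ω)
    x≡x-0 = solve-∀ ℤω-ring

  ≈-isEquivalence : IsEquivalence (λ x y → x ≈ y mod π)
  ≈-isEquivalence = record { refl = ≈-refl ; sym = ≈-sym ; trans = ≈-trans }

≈-mod-∣ : ∀ {π ρ x y} → π ∣ω ρ → x ≈ y mod ρ → x ≈ y mod π
≈-mod-∣ {π} π∣ρ (∣⇒≈ d) = ∣⇒≈ (∣ω-trans {π} π∣ρ d)

mod-setoid : ℤω → Setoid _ _
mod-setoid π = record { isEquivalence = ≈-isEquivalence {π} }

module ≈-Reasoning (π : ℤω) = Relation.Binary.Reasoning.Setoid (mod-setoid π)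

nrm : ℤω → ℤ
nrm (mkE a b) = a * a - a * b + b * b

nrm-* : ∀ x y → nrm (x *ω y) ≡ nrm x * nrm y
nrm-* (mkE a b) (mkE c d) = nrm-mul a b c d
  where
  nrm-mul : ∀ a b c d → (a * c - b * d) * (a * c - b * d) - (a * c - b * d) * (a * d + b * c - b * d)
                         + (a * d + b * c - b * d) * (a * d + b * c - b * d)
                      ≡ (a * a - a * b + b * b) * (c * c - c * d + d * d)
  nrm-mul = ℤ-Solver.solve-∀

Nω-* : ∀ x y → Nω (x *ω y) ≡ Nω x ℕ.* Nω y
Nω-* x y = trans (cong ∣_∣ (nrm-* x y)) (ℤP.abs-* (nrm x) (nrm y))

Nω-fromℤ : ∀ n → Nω (fromℤ n) ≡ ∣ n ∣ ℕ.* ∣ n ∣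
Nω-fromℤ n = trans (cong ∣_∣ (nrm-fromℤ n)) (ℤP.abs-* n n)
  where
  nrm-fromℤ : ∀ n → n * n - n * + 0 + + 0 * + 0 ≡ n * n
  nrm-fromℤ = ℤ-Solver.solve-∀

∣oneω⇒Unitω : ∀ {π} → π ∣ω oneω → Unitω π
∣oneω⇒Unitω {π} (γ , 1≡πγ) = ℕP.m*n≡1⇒m≡1 (Nω π) (Nω γ) (trans (sym (Nω-* π γ)) (cong Nω (sym 1≡πγ)))

four-Nω : ∀ a b → 4 ℕ.* Nω (mkE a b) ≡ ∣ + 2 * a - b ∣ ℕ.* ∣ + 2 * a - b ∣ ℕ.+ ∣ b ∣ ℕ.* ∣ b ∣ ℕ.* 3
four-Nω a b = begin
  4 ℕ.* ∣ nrm (mkE a b) ∣                      ≡⟨ ℤP.abs-* (+ 4) (nrm (mkE a b)) ⟨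
  ∣ + 4 * nrm (mkE a b) ∣                      ≡⟨ cong ∣_∣ (four-nrm a b) ⟩
  ∣ (+ 2 * a - b) * (+ 2 * a - b) + b * b * + 3 ∣
    ≡⟨ cong₂ (λ s t → ∣ s + t * + 3 ∣) (i*i≡∣i∣*∣i∣ (+ 2 * a - b)) (i*i≡∣i∣*∣i∣ b) ⟩
  ∣ + (u ℕ.* u) + + (v ℕ.* v) * + 3 ∣           ≡⟨ cong (λ s → ∣ + (u ℕ.* u) + s ∣) (ℤP.pos-* (v ℕ.* v) 3) ⟨
  ∣ + (u ℕ.* u) + + (v ℕ.* v ℕ.* 3) ∣          ≡⟨ cong ∣_∣ (ℤP.pos-+ (u ℕ.* u) (v ℕ.* v ℕ.* 3)) ⟨
  u ℕ.* u ℕ.+ v ℕ.* v ℕ.* 3                    ∎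
  where
  open ≡-Reasoning
  u v : ℕ
  u = ∣ + 2 * a - b ∣
  v = ∣ b ∣
  four-nrm : ∀ a b → + 4 * (a * a - a * b + b * b) ≡ (+ 2 * a - b) * (+ 2 * a - b) + b * b * + 3
  four-nrm = ℤ-Solver.solve-∀

-- By four-Nω, 4 N(x) is a square modulo 3, and squares are 0 or 1 modulo 3.
Nω%3≢2 : ∀ x → ¬ (Nω x ℕ.% 3 ≡ 2)
Nω%3≢2 (mkE a b) N%3≡2 with square%3 u | trans (sym 4N%3≡u²%3) 4N%3≡2
  where
  u : ℕ
  u = ∣ + 2 * a - b ∣
  4N%3≡u²%3 : (4 ℕ.* Nω (mkE a b)) ℕ.% 3 ≡ (u ℕ.* u) ℕ.% 3
  4N%3≡u²%3 = trans (cong (ℕ._% 3) (four-Nω a b)) ([m+kn]%n≡m%n (u ℕ.* u) (∣ b ∣ ℕ.* ∣ b ∣) 3)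
  4N%3≡2 : (4 ℕ.* Nω (mkE a b)) ℕ.% 3 ≡ 2
  4N%3≡2 = trans (%-distribˡ-* 4 (Nω (mkE a b)) 3) (cong (λ r → (1 ℕ.* r) ℕ.% 3) N%3≡2)
... | inj₁ u²%3≡0 | u²%3≡2 with () ← trans (sym u²%3≡0) u²%3≡2
... | inj₂ u²%3≡1 | u²%3≡2 with () ← trans (sym u²%3≡1) u²%3≡2

-- Powers, the Frobenius congruence and Fermat's little theorem

^ω-+ : ∀ x m n → x ^ω (m ℕ.+ n) ≡ ((x ^ω m) *ω (x ^ω n))
^ω-+ x zero n = sym (*ω-identityˡ _)
^ω-+ x (suc m) n = trans (cong (x *ω_) (^ω-+ x m n)) (sym (*ω-assoc x _ _))

^ω-* : ∀ x m n → x ^ω (m ℕ.* n) ≡ (x ^ω m) ^ω n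
^ω-* x m zero = cong (x ^ω_) (ℕP.*-zeroʳ m)
^ω-* x m (suc n) = begin
  x ^ω (m ℕ.* suc n)               ≡⟨ cong (x ^ω_) (ℕP.*-suc m n) ⟩
  x ^ω (m ℕ.+ m ℕ.* n)             ≡⟨ ^ω-+ x m (m ℕ.* n) ⟩
  ((x ^ω m) *ω (x ^ω (m ℕ.* n)))   ≡⟨ cong ((x ^ω m) *ω_) (^ω-* x m n) ⟩
  (x ^ω m) ^ω suc n                ∎
  where open ≡-Reasoning

^ω-distrib-*ω : ∀ x y n → (x *ω y) ^ω n ≡ ((x ^ω n) *ω (y ^ω n))
^ω-distrib-*ω x y zero = refl
^ω-distrib-*ω x y (suc n) = trans (cong ((x *ω y) *ω_) (^ω-distrib-*ω x y n)) (interchange x y (x ^ω n) (y ^ω n))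
  where
  interchange : ∀ x y u v → ((x *ω y) *ω (u *ω v)) ≡ ((x *ω u) *ω (y *ω v))
  interchange = solve-∀ ℤω-ring

oneω^ω : ∀ n → oneω ^ω n ≡ oneω
oneω^ω zero = refl
oneω^ω (suc n) = trans (*ω-identityˡ _) (oneω^ω n)

ℤω-commutativeSemiring : CommutativeSemiring _ _
ℤω-commutativeSemiring = CommutativeRing.commutativeSemiring ℤω-commutativeRing

open import Algebra.Properties.CommutativeSemiring.Binomial ℤω-commutativeSemiring using (theorem; binomialTerm)
open import Algebra.Properties.Semiring.Mult (CommutativeSemiring.semiring ℤω-commutativeSemiring)
  using () renaming (_×_ to _·ω_)
open import Algebra.Properties.Semiring.Exp (CommutativeSemiring.semiring ℤω-commutativeSemiring)
  using () renaming (_^_ to _^′_)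
open import Algebra.Properties.Semiring.Sum (CommutativeSemiring.semiring ℤω-commutativeSemiring)
  using (sum)

^′≡^ω : ∀ x n → x ^′ n ≡ x ^ω n
^′≡^ω x zero = refl
^′≡^ω x (suc n) = cong (x *ω_) (^′≡^ω x n)

·ω≡fromℤ*ω : ∀ n x → n ·ω x ≡ (fromℤ (+ n) *ω x)
·ω≡fromℤ*ω zero x = sym (*ω-zeroˡ x)
·ω≡fromℤ*ω (suc n) x = trans (cong (x +ω_) (·ω≡fromℤ*ω n x)) (1+n x (fromℤ (+ n)))
  where
  1+n : ∀ x n → (x +ω (n *ω x)) ≡ ((oneω +ω n) *ω x)
  1+n = solve-∀ ℤω-ring

∣⇒fromℤ∣ω·ω : ∀ {p} n x → p ℕD.∣ n → fromℤ (+ p) ∣ω (n ·ω x)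
∣⇒fromℤ∣ω·ω {p} n x (divides q refl) = fromℤ (+ q) *ω x , (begin
  (q ℕ.* p) ·ω x                               ≡⟨ ·ω≡fromℤ*ω (q ℕ.* p) x ⟩
  (fromℤ (+ (q ℕ.* p)) *ω x)                   ≡⟨ cong (λ n → fromℤ n *ω x) (ℤP.pos-* q p) ⟩
  (fromℤ (+ q * + p) *ω x)                     ≡⟨ cong (_*ω x) (fromℤ-* (+ q) (+ p)) ⟩
  ((fromℤ (+ q) *ω fromℤ (+ p)) *ω x)          ≡⟨ rearrange (fromℤ (+ q)) (fromℤ (+ p)) x ⟩
  (fromℤ (+ p) *ω (fromℤ (+ q) *ω x))          ∎)
  where
  open ≡-Reasoning
  rearrange : ∀ u v x → ((u *ω v) *ω x) ≡ (v *ω (u *ω x))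
  rearrange = solve-∀ ℤω-ring

sum≈last : ∀ {ρ} m (h : Fin (suc m) → ℤω) → (∀ k → h (inject₁ k) ≈ 0ω mod ρ) → sum h ≈ h (fromℕ m) mod ρ
sum≈last zero h _ = ≡⇒≈ (+ω-identityʳ (h zero))
sum≈last (suc m) h h≈0 = ≈-trans (≈-+ (h≈0 zero) (sum≈last m (λ k → h (suc k)) (λ k → h≈0 (suc k))))
                                 (≡⇒≈ (+ω-identityˡ _))

-- The binomial theorem; all terms but the first and the last have a coefficient divisible by p.
frobenius : ∀ {p} → Prime p → ∀ x y → (x +ω y) ^ω p ≈ ((x ^ω p) +ω (y ^ω p)) mod fromℤ (+ p)
frobenius {zero} (prime ⦃ () ⦄ _)
frobenius {suc m} p-prime x y = begin
  (x +ω y) ^ω p                               ≡⟨ sym (^′≡^ω (x +ω y) p) ⟩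
  (x +ω y) ^′ p                               ≡⟨ theorem p x y ⟩
  (term zero +ω sum (λ k → term (suc k)))     ≈⟨ ≈-+ (≈-refl {x = term zero}) (sum≈last m (λ k → term (suc k)) middle≈0) ⟩
  (term zero +ω term (suc (fromℕ m)))         ≡⟨ cong₂ _+ω_ first last ⟩
  ((y ^ω p) +ω (x ^ω p))                      ≡⟨ +ω-comm (y ^ω p) (x ^ω p) ⟩
  ((x ^ω p) +ω (y ^ω p))                      ∎
  where
  open ≈-Reasoning (fromℤ (+ suc m))
  p : ℕ
  p = suc m
  term : Fin (suc p) → ℤω
  term = binomialTerm x y p
  first : term zero ≡ y ^ω p
  first = trans (cong₂ (λ u v → (u *ω v) +ω 0ω) (refl {x = oneω}) (^′≡^ω y p)) (one*y+0 (y ^ω p))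
    where
    one*y+0 : ∀ y → ((oneω *ω y) +ω 0ω) ≡ y
    one*y+0 = solve-∀ ℤω-ring
  last : term (suc (fromℕ m)) ≡ x ^ω p
  last = trans (cong (λ j → (p choose j) ·ω ((x ^′ j) *ω (y ^′ (p ℕ.∸ j)))) (cong suc (FinP.toℕ-fromℕ m)))
         (trans (cong₂ (λ c k → c ·ω ((x ^′ p) *ω (y ^′ k))) (nCn≡1 p) (ℕP.n∸n≡0 p))
         (trans (cong (λ z → (z *ω oneω) +ω 0ω) (^′≡^ω x p)) (x*1+0 (x ^ω p))))
    where
    x*1+0 : ∀ x → ((x *ω oneω) +ω 0ω) ≡ x
    x*1+0 = solve-∀ ℤω-ring
  middle≈0 : ∀ (k : Fin m) → term (suc (inject₁ k)) ≈ 0ω mod fromℤ (+ p)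
  middle≈0 k = ∣⇒≈0 (∣⇒fromℤ∣ω·ω (p choose suc (toℕ (inject₁ k))) _
    (p∣p-choose-k p-prime (ℕ.s≤s ℕ.z≤n) (ℕ.s≤s (subst (ℕ._< m) (sym (FinP.toℕ-inject₁ k)) (FinP.toℕ<n k)))))

0ω^ω1+n : ∀ m → 0ω ^ω suc m ≡ 0ω
0ω^ω1+n m = *ω-zeroˡ (0ω ^ω m)

-- Expand 0 = (z − z)^p by the Frobenius congruence.
negω^p≈ : ∀ {p} → Prime p → ∀ z → negω z ^ω p ≈ negω (z ^ω p) mod fromℤ (+ p)
negω^p≈ {zero} (prime ⦃ () ⦄ _)
negω^p≈ {suc m} p-prime z = begin
  negω z ^ω p                                          ≡⟨ w≡u+w-u (z ^ω p) (negω z ^ω p) ⟩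
  (((z ^ω p) +ω (negω z ^ω p)) +ω negω (z ^ω p))       ≈⟨ ≈-+ (≈-sym 0≈z^p+[-z]^p) (≈-refl {x = negω (z ^ω p)}) ⟩
  (0ω +ω negω (z ^ω p))                                ≡⟨ +ω-identityˡ (negω (z ^ω p)) ⟩
  negω (z ^ω p)                                        ∎
  where
  open ≈-Reasoning (fromℤ (+ suc m))
  p : ℕ
  p = suc m
  w≡u+w-u : ∀ u w → w ≡ ((u +ω w) +ω negω u)
  w≡u+w-u = solve-∀ ℤω-ring
  z-z≡0 : ∀ z → (z +ω negω z) ≡ 0ω
  z-z≡0 = solve-∀ ℤω-ring
  0≈z^p+[-z]^p : 0ω ≈ ((z ^ω p) +ω (negω z ^ω p)) mod fromℤ (+ p)
  0≈z^p+[-z]^p = ≈-trans (≡⇒≈ (trans (sym (0ω^ω1+n m)) (cong (_^ω p) (sym (z-z≡0 z))))) (frobenius p-prime z (negω z))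

pos^p≈pos : ∀ {p} → Prime p → ∀ n → fromℤ (+ n) ^ω p ≈ fromℤ (+ n) mod fromℤ (+ p)
pos^p≈pos {zero} (prime ⦃ () ⦄ _)
pos^p≈pos {suc m} p-prime zero = ≡⇒≈ (0ω^ω1+n m)
pos^p≈pos {suc m} p-prime (suc n) =
  ≈-trans (frobenius p-prime oneω (fromℤ (+ n))) (≈-+ (≡⇒≈ (oneω^ω (suc m))) (pos^p≈pos p-prime n))

fromℤ^p≈fromℤ : ∀ {p} → Prime p → ∀ n → fromℤ n ^ω p ≈ fromℤ n mod fromℤ (+ p)
fromℤ^p≈fromℤ p-prime (+ n) = pos^p≈pos p-prime n
fromℤ^p≈fromℤ p-prime -[1+ n ] =
  ≈-trans (negω^p≈ p-prime (fromℤ (+ suc n))) (≈-negω (pos^p≈pos p-prime (suc n)))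

frobenius-linear : ∀ {p} → Prime p → ∀ x y ζ →
  (fromℤ x +ω (fromℤ y *ω ζ)) ^ω p ≈ (fromℤ x +ω (fromℤ y *ω (ζ ^ω p))) mod fromℤ (+ p)
frobenius-linear {p} p-prime x y ζ =
  ≈-trans (frobenius p-prime (fromℤ x) (fromℤ y *ω ζ))
    (≈-+ (fromℤ^p≈fromℤ p-prime x)
         (≈-trans (≡⇒≈ (^ω-distrib-*ω (fromℤ y) ζ p)) (≈-* (fromℤ^p≈fromℤ p-prime y) (≈-refl {x = ζ ^ω p}))))

frobenius-linear-iterate : ∀ {p} → Prime p → ∀ j x y ζ →
  (fromℤ x +ω (fromℤ y *ω ζ)) ^ω (p ℕ.^ j) ≈ (fromℤ x +ω (fromℤ y *ω (ζ ^ω (p ℕ.^ j)))) mod fromℤ (+ p)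
frobenius-linear-iterate p-prime zero x y ζ = ≡⇒≈ (^ω1 (fromℤ x) (fromℤ y) ζ)
  where
  ^ω1 : ∀ u v ζ → ((u +ω (v *ω ζ)) *ω oneω) ≡ (u +ω (v *ω (ζ *ω oneω)))
  ^ω1 = solve-∀ ℤω-ring
frobenius-linear-iterate {p} p-prime (suc j) x y ζ = begin
  γ ^ω (p ℕ.* q)                                  ≡⟨ ^ω-* γ p q ⟩
  (γ ^ω p) ^ω q                                   ≈⟨ ≈-^ q (frobenius-linear p-prime x y ζ) ⟩
  (fromℤ x +ω (fromℤ y *ω (ζ ^ω p))) ^ω q         ≈⟨ frobenius-linear-iterate p-prime j x y (ζ ^ω p) ⟩
  (fromℤ x +ω (fromℤ y *ω ((ζ ^ω p) ^ω q)))       ≡⟨ cong (λ z → fromℤ x +ω (fromℤ y *ω z)) (^ω-* ζ p q) ⟨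
  (fromℤ x +ω (fromℤ y *ω (ζ ^ω (p ℕ.* q))))      ∎
  where
  open ≈-Reasoning (fromℤ (+ p))
  q : ℕ
  q = p ℕ.^ j
  γ : ℤω
  γ = fromℤ x +ω (fromℤ y *ω ζ)

ω^ω≡ω^ω[%3] : ∀ n → ω ^ω n ≡ ω ^ω (n ℕ.% 3)
ω^ω≡ω^ω[%3] n = begin
  ω ^ω n                                              ≡⟨ cong (ω ^ω_) (m≡m%n+[m/n]*n n 3) ⟩
  ω ^ω (n ℕ.% 3 ℕ.+ n ℕ./ 3 ℕ.* 3)                    ≡⟨ ^ω-+ ω (n ℕ.% 3) _ ⟩
  ((ω ^ω (n ℕ.% 3)) *ω (ω ^ω (n ℕ./ 3 ℕ.* 3)))        ≡⟨ cong (λ k → (ω ^ω (n ℕ.% 3)) *ω (ω ^ω k)) (ℕP.*-comm (n ℕ./ 3) 3) ⟩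
  ((ω ^ω (n ℕ.% 3)) *ω (ω ^ω (3 ℕ.* (n ℕ./ 3))))      ≡⟨ cong ((ω ^ω (n ℕ.% 3)) *ω_) (trans (^ω-* ω 3 (n ℕ./ 3)) (oneω^ω (n ℕ./ 3))) ⟩
  ((ω ^ω (n ℕ.% 3)) *ω oneω)                          ≡⟨ *ω-identityʳ (ω ^ω (n ℕ.% 3)) ⟩
  ω ^ω (n ℕ.% 3)                                      ∎
  where open ≡-Reasoning

-- Since ω^(p^j) = ω, the iterated Frobenius fixes x + yω.
fermat : ∀ {p} → Prime p → ∀ j → (p ℕ.^ j) ℕ.% 3 ≡ 1 → ∀ γ → γ ^ω (p ℕ.^ j) ≈ γ mod fromℤ (+ p)
fermat {p} p-prime j q%3≡1 (mkE x y) = begin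
  mkE x y ^ω q                              ≡⟨ cong (_^ω q) (x+yω x y) ⟩
  (fromℤ x +ω (fromℤ y *ω ω)) ^ω q          ≈⟨ frobenius-linear-iterate p-prime j x y ω ⟩
  (fromℤ x +ω (fromℤ y *ω (ω ^ω q)))        ≡⟨ cong (λ z → fromℤ x +ω (fromℤ y *ω z)) (trans (ω^ω≡ω^ω[%3] q) (cong (ω ^ω_) q%3≡1)) ⟩
  (fromℤ x +ω (fromℤ y *ω (ω ^ω 1)))        ≡⟨ x+yω¹ x y ⟨
  mkE x y                                   ∎
  where
  open ≈-Reasoning (fromℤ (+ p))
  q : ℕ
  q = p ℕ.^ j
  x+yω : ∀ x y → mkE x y ≡ (fromℤ x +ω (fromℤ y *ω ω))
  x+yω x y = cong₂ mkE (re-x+yω x y) (im-x+yω x y)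
    where
    re-x+yω : ∀ x y → x ≡ x + (y * + 0 - + 0 * + 1)
    re-x+yω = ℤ-Solver.solve-∀
    im-x+yω : ∀ x y → y ≡ + 0 + (y * + 1 + + 0 * + 0 - + 0 * + 1)
    im-x+yω = ℤ-Solver.solve-∀
  x+yω¹ : ∀ x y → mkE x y ≡ (fromℤ x +ω (fromℤ y *ω (ω ^ω 1)))
  x+yω¹ x y = trans (x+yω x y) (cong (λ z → fromℤ x +ω (fromℤ y *ω z)) (sym (*ω-identityʳ ω)))

-- Primes of ℤ[ω] and the cubic residue symbol

prime∣ω-product : ∀ {π} → Primeω π → ∀ {qs} → All Prime qs → π ∣ω fromℤ (+ product qs) →
  Σ ℕ λ p → Prime p × π ∣ω fromℤ (+ p)
prime∣ω-product {π} (_ , π-nonunit , _) All.[] π∣1 = ⊥-elim (π-nonunit (∣oneω⇒Unitω {π} π∣1))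
prime∣ω-product {π} π-prime@(_ , _ , π-split) {q ∷ qs} (q-prime All.∷ qs-prime) π∣qQ
  with π-split (fromℤ (+ q)) (fromℤ (+ product qs)) (subst (π ∣ω_) (fromℤ-pos-* q (product qs)) π∣qQ)
... | inj₁ π∣q = q , q-prime , π∣q
... | inj₂ π∣Q = prime∣ω-product π-prime qs-prime π∣Q

prime-below : ∀ {π} → Primeω π → ∀ n → .{{_ : ℕ.NonZero n}} → π ∣ω fromℤ (+ n) →
  Σ ℕ λ p → Prime p × π ∣ω fromℤ (+ p)
prime-below {π} π-prime n π∣n = prime∣ω-product π-prime (factorsPrime (factorise n))
  (subst (λ m → π ∣ω fromℤ (+ m)) (isFactorisation (factorise n)) π∣n)
  where open PrimeFactorisation

module _ {π : ℤω} (π-prime : Primeω π) {p : ℕ} (p-prime : Prime p) (π∣p : π ∣ω fromℤ (+ p)) where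

  Nω∣p*p : Nω π ℕD.∣ p ℕ.* p
  Nω∣p*p = divides (Nω γ) (begin
    p ℕ.* p             ≡⟨ Nω-fromℤ (+ p) ⟨
    Nω (fromℤ (+ p))    ≡⟨ cong Nω p≡πγ ⟩
    Nω (π *ω γ)         ≡⟨ Nω-* π γ ⟩
    Nω π ℕ.* Nω γ       ≡⟨ ℕP.*-comm (Nω π) (Nω γ) ⟩
    Nω γ ℕ.* Nω π       ∎)
    where
    open ≡-Reasoning
    γ : ℤω
    γ = proj₁ π∣p
    p≡πγ : fromℤ (+ p) ≡ (π *ω γ)
    p≡πγ = proj₂ π∣p

  Nω≡p^[1+j] : Σ ℕ λ j → Nω π ≡ p ℕ.^ suc j
  Nω≡p^[1+j] = [ (λ N≡1 → ⊥-elim (proj₁ (proj₂ π-prime) N≡1)) , (λ N≡p^[1+j] → N≡p^[1+j]) ]′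
                 (∣p*p⇒≡1⊎≡p^[1+j] p-prime Nω∣p*p)

  p∣Nω : p ℕD.∣ Nω π
  p∣Nω = subst (p ℕD.∣_) (sym (proj₂ Nω≡p^[1+j])) (ℕD.m∣m*n (p ℕ.^ proj₁ Nω≡p^[1+j]))

  ∣ω-fromℤ⇒∣ : ∀ {m} → π ∣ω fromℤ m → p ℕD.∣ ∣ m ∣
  ∣ω-fromℤ⇒∣ {m} (γ , m≡πγ) = reduce (euclidsLemma ∣ m ∣ ∣ m ∣ p-prime p∣m*m)
    where
    m*m≡Nπ*Nγ : ∣ m ∣ ℕ.* ∣ m ∣ ≡ Nω π ℕ.* Nω γ
    m*m≡Nπ*Nγ = trans (sym (Nω-fromℤ m)) (trans (cong Nω m≡πγ) (Nω-* π γ))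
    p∣m*m : p ℕD.∣ ∣ m ∣ ℕ.* ∣ m ∣
    p∣m*m = subst (p ℕD.∣_) (sym m*m≡Nπ*Nγ) (ℕD.∣m⇒∣m*n (Nω γ) p∣Nω)

  module _ (π∤3 : ¬ π ∣ω fromℤ (+ 3)) where

    3∤Nω : ¬ 3 ℕD.∣ Nω π
    3∤Nω 3∣N = [ (λ ()) , (λ 3≡p → π∤3 (subst (λ q → π ∣ω fromℤ (+ q)) (sym 3≡p) π∣p)) ]′
                 (prime⇒irreducible p-prime (prime∣m^[1+n]⇒∣m (from-yes (prime? 3)) (proj₁ Nω≡p^[1+j])
                   (subst (3 ℕD.∣_) (proj₂ Nω≡p^[1+j]) 3∣N)))

    Nω%3≡1 : Nω π ℕ.% 3 ≡ 1
    Nω%3≡1 = ¬3∣n∧n%3≢2⇒n%3≡1 (Nω π) 3∤Nω (Nω%3≢2 π)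

    fermat-π : ∀ γ → γ ^ω Nω π ≈ γ mod π
    fermat-π γ = ≈-mod-∣ {π} π∣p (subst (λ n → γ ^ω n ≈ γ mod fromℤ (+ p)) (sym N≡p^[1+j])
                   (fermat p-prime (suc j) (subst (λ n → n ℕ.% 3 ≡ 1) N≡p^[1+j] Nω%3≡1) γ))
      where
      j : ℕ
      j = proj₁ Nω≡p^[1+j]
      N≡p^[1+j] : Nω π ≡ p ℕ.^ suc j
      N≡p^[1+j] = proj₂ Nω≡p^[1+j]

    ^[Nω∸1]≈oneω : ∀ {γ} → ¬ π ∣ω γ → γ ^ω (Nω π ℕ.∸ 1) ≈ oneω mod π
    ^[Nω∸1]≈oneω {γ} π∤γ = [ (λ π∣γ → ⊥-elim (π∤γ π∣γ)) , ∣⇒≈ ]′ (proj₂ (proj₂ π-prime) γ ((γ ^ω n) -ω oneω) π∣γ[γ^n-1])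
      where
      n : ℕ
      n = Nω π ℕ.∸ 1
      γ*γ^n-γ≡γ[γ^n-1] : ∀ γ u → ((γ *ω u) +ω negω γ) ≡ (γ *ω (u +ω negω oneω))
      γ*γ^n-γ≡γ[γ^n-1] = solve-∀ ℤω-ring
      π∣γ[γ^n-1] : π ∣ω (γ *ω ((γ ^ω n) -ω oneω))
      π∣γ[γ^n-1] = subst (π ∣ω_) (γ*γ^n-γ≡γ[γ^n-1] γ (γ ^ω n))
        (≈⇒∣ (subst (λ N → γ ^ω N ≈ γ mod π) (sym (n%3≡1⇒1+[n∸1]≡n (Nω π) Nω%3≡1)) (fermat-π γ)))

    cube^[[Nω∸1]/3]≈oneω : ∀ {γ} → ¬ π ∣ω γ → (γ ^ω 3) ^ω ((Nω π ℕ.∸ 1) ℕ./ 3) ≈ oneω mod π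
    cube^[[Nω∸1]/3]≈oneω {γ} π∤γ =
      ≈-trans (≡⇒≈ (trans (sym (^ω-* γ 3 _)) (cong (γ ^ω_) (n%3≡1⇒3*[[n∸1]/3]≡n∸1 (Nω π) Nω%3≡1)))) (^[Nω∸1]≈oneω π∤γ)

    CubicSymP-transfer : ∀ {U V α α′} → ¬ π ∣ω U → ¬ π ∣ω V →
      ((U ^ω 3) *ω α) ≈ ((V ^ω 3) *ω α′) mod π → ∀ ζ → CubicSymP α π ζ → CubicSymP α′ π ζ
    CubicSymP-transfer {U} {V} {α} {α′} π∤U π∤V U³α≈V³α′ ζ α^k≈ζ = ≈⇒∣ (begin
      α′ ^ω k                                  ≡⟨ *ω-identityˡ (α′ ^ω k) ⟨
      (oneω *ω (α′ ^ω k))                      ≈⟨ ≈-* (≈-sym (cube^[[Nω∸1]/3]≈oneω π∤V)) (≈-refl {x = α′ ^ω k}) ⟩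
      (((V ^ω 3) ^ω k) *ω (α′ ^ω k))           ≡⟨ ^ω-distrib-*ω (V ^ω 3) α′ k ⟨
      ((V ^ω 3) *ω α′) ^ω k                    ≈⟨ ≈-^ k (≈-sym U³α≈V³α′) ⟩
      ((U ^ω 3) *ω α) ^ω k                     ≡⟨ ^ω-distrib-*ω (U ^ω 3) α k ⟩
      (((U ^ω 3) ^ω k) *ω (α ^ω k))            ≈⟨ ≈-* (cube^[[Nω∸1]/3]≈oneω π∤U) (≈-refl {x = α ^ω k}) ⟩
      (oneω *ω (α ^ω k))                       ≡⟨ *ω-identityˡ (α ^ω k) ⟩
      α ^ω k                                   ≈⟨ ∣⇒≈ α^k≈ζ ⟩
      ⟦ ζ ⟧c                                   ∎)
      where
      open ≈-Reasoning π
      k : ℕ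
      k = (Nω π ℕ.∸ 1) ℕ./ 3

CubicSym-transfer : ∀ {α α′ n ζ} →
  (∀ {π} → Primeω π → ¬ π ∣ω fromℤ (+ 3) → π ∣ω fromℤ (+ n) → ∀ ζ → CubicSymP α π ζ → CubicSymP α′ π ζ) →
  CubicSym α n ζ → CubicSym α′ n ζ
CubicSym-transfer {α} {α′} {n} local (πs , ζs , factored , (e , e-unit , n≡eΠ) , ζ≡Πζs) =
  πs , ζs , transfer factored (e , trans n≡eΠ (*ω-comm e (prodω πs))) , (e , e-unit , n≡eΠ) , ζ≡Πζs
  where
  transfer : ∀ {πs ζs} → Factored α πs ζs → prodω πs ∣ω fromℤ (+ n) → Factored α′ πs ζs
  transfer [] _ = []
  transfer {π ∷ πs} {ζ ∷ _} ((π-prime , π∤3 , α-symbol) ∷ rest) ππs∣n =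
    (π-prime , π∤3 , local π-prime π∤3 π∣n ζ α-symbol) ∷ transfer rest πs∣n
    where
    π∣n : π ∣ω fromℤ (+ n)
    π∣n = ∣ω-trans {π} (prodω πs , refl) ππs∣n
    πs∣n : prodω πs ∣ω fromℤ (+ n)
    πs∣n = ∣ω-trans {prodω πs} (π , *ω-comm π (prodω πs)) ππs∣n

CP? : ∀ D g → Decidable (CP D g)
CP? D g p = prime? p ×-dec ((p ℕ.% 2) ℕ.≟ 1) ×-dec (p ℕD.∣? g) ×-dec ¬? (p ℕD.∣? D)

-- Cof D A B is definitionally Cofℕ D (gcd ∣ A ∣ ∣ B ∣).
Cofℕ : ℕ → ℕ → ℕ
Cofℕ D g = product (filter (CP? D g) (upTo (suc g)))

filter-upTo-+ : ∀ {P : ℕ → Set} (P? : Decidable P) n → (∀ m → n ℕ.≤ m → ¬ P m) → ∀ k →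
  filter P? (upTo n) ≡ filter P? (upTo (n ℕ.+ k))
filter-upTo-+ P? n none zero = cong (λ m → filter P? (upTo m)) (sym (ℕP.+-identityʳ n))
filter-upTo-+ P? n none (suc k) = begin
  filter P? (upTo n)                               ≡⟨ filter-upTo-+ P? n none k ⟩
  filter P? (upTo (n ℕ.+ k))                         ≡⟨ ListP.++-identityʳ _ ⟨
  filter P? (upTo (n ℕ.+ k)) ++ []                   ≡⟨ cong (filter P? (upTo (n ℕ.+ k)) ++_)
                                                       (ListP.filter-reject P? (none (n ℕ.+ k) (ℕP.m≤m+n n k))) ⟨
  filter P? (upTo (n ℕ.+ k)) ++ filter P? [ n ℕ.+ k ]  ≡⟨ ListP.filter-++ P? (upTo (n ℕ.+ k)) [ n ℕ.+ k ] ⟨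
  filter P? (upTo (n ℕ.+ k) ++ [ n ℕ.+ k ])            ≡⟨ cong (filter P?) (ListP.upTo-∷ʳ (n ℕ.+ k)) ⟩
  filter P? (upTo (suc (n ℕ.+ k)))                   ≡⟨ cong (λ m → filter P? (upTo m)) (ℕP.+-suc n k) ⟨
  filter P? (upTo (n ℕ.+ suc k))                     ∎
  where open ≡-Reasoning

Cofℕ-cong : ∀ D g g′ → g ≢ 0 → g′ ≢ 0 →
  (∀ p → Prime p → ¬ p ℕD.∣ D → (p ℕD.∣ g → p ℕD.∣ g′) × (p ℕD.∣ g′ → p ℕD.∣ g)) → Cofℕ D g ≡ Cofℕ D g′
Cofℕ-cong D g g′ g≢0 g′≢0 same-primes = cong product (begin
  filter (CP? D g) (upTo (suc g))          ≡⟨ filter-upTo-+ (CP? D g) (suc g) (none-above g≢0) g′ ⟩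
  filter (CP? D g) (upTo (suc g ℕ.+ g′))     ≡⟨ ListP.filter-≐ (CP? D g) (CP? D g′) (to , from) (upTo (suc g ℕ.+ g′)) ⟩
  filter (CP? D g′) (upTo (suc g ℕ.+ g′))    ≡⟨ cong (λ m → filter (CP? D g′) (upTo (suc m))) (ℕP.+-comm g g′) ⟩
  filter (CP? D g′) (upTo (suc g′ ℕ.+ g))    ≡⟨ filter-upTo-+ (CP? D g′) (suc g′) (none-above g′≢0) g ⟨
  filter (CP? D g′) (upTo (suc g′))        ∎)
  where
  open ≡-Reasoning
  none-above : ∀ {h} → h ≢ 0 → ∀ m → suc h ℕ.≤ m → ¬ CP D h m
  none-above h≢0 m h<m (_ , _ , m∣h , _) = ℕP.<⇒≱ h<m (ℕD.∣⇒≤ ⦃ ℕ.≢-nonZero h≢0 ⦄ m∣h)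
  to : ∀ {p} → CP D g p → CP D g′ p
  to (p-prime , odd , p∣g , p∤D) = p-prime , odd , proj₁ (same-primes _ p-prime p∤D) p∣g , p∤D
  from : ∀ {p} → CP D g′ p → CP D g p
  from (p-prime , odd , p∣g′ , p∤D) = p-prime , odd , proj₂ (same-primes _ p-prime p∤D) p∣g′ , p∤D

Cofℕ-factors : ∀ D g → All (λ p → Prime p × p ℕD.∣ g) (filter (CP? D g) (upTo (suc g)))
Cofℕ-factors D g = All.tabulate λ p∈ → case proj₂ (∈-filter⁻ (CP? D g) {xs = upTo (suc g)} p∈) of
  λ { (p-prime , _ , p∣g , _) → p-prime , p∣g }

Cofℕ∣ : ∀ D g → Cofℕ D g ℕD.∣ g
Cofℕ∣ D g = product-∣ _ (filter⁺ (CP? D g) (upTo⁺ (suc g))) (Cofℕ-factors D g)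

Cofℕ≢0 : ∀ D g → Cofℕ D g ≢ 0
Cofℕ≢0 D g Cof≡0 = ℕP.<⇒≢ (productOfPrimes≥1 (All.map proj₁ (Cofℕ-factors D g))) (sym Cof≡0)

-- The subring ℤ[√-3] of ℤ[ω]

√-3 : ℤω
√-3 = mkE (+ 1) (+ 2)

infix 5 _+√-3·_
record ℤ[√-3] : Set where
  constructor _+√-3·_
  field
    rational : ℤ
    irrational : ℤ

infixl 6 _⊕_
_⊕_ : ℤ[√-3] → ℤ[√-3] → ℤ[√-3]
(u +√-3· v) ⊕ (u′ +√-3· v′) = u + u′ +√-3· v + v′

infixl 7 _⊗_
_⊗_ : ℤ[√-3] → ℤ[√-3] → ℤ[√-3]
(u +√-3· v) ⊗ (u′ +√-3· v′) = u * u′ - + 3 * (v * v′) +√-3· u * v′ + v * u′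

cube : ℤ[√-3] → ℤ[√-3]
cube x = x ⊗ (x ⊗ x)

-- Stating the target coordinates lets the ring solver see both sides syntactically.
⊗-≡ : ∀ u v u′ v′ {X Y} → u * u′ - + 3 * (v * v′) ≡ X → u * v′ + v * u′ ≡ Y → (u +√-3· v) ⊗ (u′ +√-3· v′) ≡ (X +√-3· Y)
⊗-≡ u v u′ v′ = cong₂ _+√-3·_

cube-≡ : ∀ u v {X Y} → u * u * u - + 9 * (u * v * v) ≡ X → + 3 * (u * u * v) - + 3 * (v * v * v) ≡ Y →
  cube (u +√-3· v) ≡ (X +√-3· Y)
cube-≡ u v refl refl = cong₂ _+√-3·_ (rational-cube u v) (irrational-cube u v)
  where
  rational-cube : ∀ u v → u * (u * u - + 3 * (v * v)) - + 3 * (v * (u * v + v * u)) ≡ u * u * u - + 9 * (u * v * v)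
  rational-cube = ℤ-Solver.solve-∀
  irrational-cube : ∀ u v → u * (u * v + v * u) + v * (u * u - + 3 * (v * v)) ≡ + 3 * (u * u * v) - + 3 * (v * v * v)
  irrational-cube = ℤ-Solver.solve-∀

cube-√-3 : ∀ v → cube (+ 0 +√-3· v) ≡ (+ 0 +√-3· - (+ 3 * (v * v * v)))
cube-√-3 v = cube-≡ (+ 0) v (ℤ-Solver.solve (v ∷ [])) (ℤ-Solver.solve (v ∷ []))

cube-rational : ∀ u → cube (u +√-3· + 0) ≡ (u * u * u +√-3· + 0)
cube-rational u = cube-≡ u (+ 0) (ℤ-Solver.solve (u ∷ [])) (ℤ-Solver.solve (u ∷ []))

toℤω : ℤ[√-3] → ℤω
toℤω (u +√-3· v) = mkE (u + v) (+ 2 * v)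

toℤω-⊗ : ∀ x y → toℤω (x ⊗ y) ≡ (toℤω x *ω toℤω y)
toℤω-⊗ (u +√-3· v) (u′ +√-3· v′) = cong₂ mkE (re-* u v u′ v′) (im-* u v u′ v′)
  where
  re-* : ∀ u v u′ v′ → u * u′ - + 3 * (v * v′) + (u * v′ + v * u′) ≡ (u + v) * (u′ + v′) - + 2 * v * (+ 2 * v′)
  re-* = ℤ-Solver.solve-∀
  im-* : ∀ u v u′ v′ → + 2 * (u * v′ + v * u′) ≡ (u + v) * (+ 2 * v′) + + 2 * v * (u′ + v′) - + 2 * v * (+ 2 * v′)
  im-* = ℤ-Solver.solve-∀

toℤω-⊕ : ∀ x y → toℤω (x ⊕ y) ≡ (toℤω x +ω toℤω y)
toℤω-⊕ (u +√-3· v) (u′ +√-3· v′) = cong₂ mkE (re-+ u v u′ v′) (im-+ v v′)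
  where
  re-+ : ∀ u v u′ v′ → u + u′ + (v + v′) ≡ u + v + (u′ + v′)
  re-+ = ℤ-Solver.solve-∀
  im-+ : ∀ v v′ → + 2 * (v + v′) ≡ + 2 * v + + 2 * v′
  im-+ = ℤ-Solver.solve-∀

toℤω-cube : ∀ x → toℤω (cube x) ≡ toℤω x ^ω 3
toℤω-cube x = trans (toℤω-⊗ x (x ⊗ x)) (trans (cong (toℤω x *ω_) (toℤω-⊗ x x)) (x*[x*x]≡x^3 (toℤω x)))
  where
  x*[x*x]≡x^3 : ∀ x → (x *ω (x *ω x)) ≡ (x *ω (x *ω (x *ω oneω)))
  x*[x*x]≡x^3 = solve-∀ ℤω-ring

fromℤ≡toℤω : ∀ u → fromℤ u ≡ toℤω (u +√-3· + 0)
fromℤ≡toℤω u = cong₂ mkE (sym (u+0≡u u)) refl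
  where
  u+0≡u : ∀ u → u + + 0 ≡ u
  u+0≡u = ℤ-Solver.solve-∀

fromℤ*√-3≡toℤω : ∀ v → (fromℤ v *ω √-3) ≡ toℤω (+ 0 +√-3· v)
fromℤ*√-3≡toℤω v = cong₂ mkE (re-√ v) (im-√ v)
  where
  re-√ : ∀ v → v * + 1 - + 0 * + 2 ≡ + 0 + v
  re-√ = ℤ-Solver.solve-∀
  im-√ : ∀ v → v * + 2 + + 0 * + 1 - + 0 * + 2 ≡ + 2 * v
  im-√ = ℤ-Solver.solve-∀

fromℤ-fromℤ*√-3≡toℤω : ∀ u v → (fromℤ u -ω (fromℤ v *ω √-3)) ≡ toℤω (u +√-3· - v)
fromℤ-fromℤ*√-3≡toℤω u v = cong₂ mkE (re-√ u v) (im-√ v)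
  where
  re-√ : ∀ u v → u - (v * + 1 - + 0 * + 2) ≡ u + - v
  re-√ = ℤ-Solver.solve-∀
  im-√ : ∀ v → + 0 - (v * + 2 + + 0 * + 1 - + 0 * + 2) ≡ + 2 * - v
  im-√ = ℤ-Solver.solve-∀

cubic-relation-ℤ[√-3] : ∀ A B₀ A₂ B₂₀ b C D t →
  t * t * t * A₂ ≡ B₀ * C * D * D → C * t * t * t * B₂₀ ≡ A * D →
  cube (+ 0 +√-3· b) ⊗ (+ 9 * A +√-3· - (B₀ * b)) ⊕ cube (+ 9 * C * t +√-3· + 0) ⊗ (+ 9 * A₂ +√-3· - (B₂₀ * b))
    ≡ (b * b + + 27 * C * C * D +√-3· + 0) ⊗ (- (+ 9 * B₀ * (b * b - + 27 * C * C * D)) +√-3· - (+ 27 * A * b))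
cubic-relation-ℤ[√-3] A B₀ A₂ B₂₀ b C D t t³A₂≡B₀CD² Ct³B₂₀≡AD = begin
  cube (+ 0 +√-3· b) ⊗ (+ 9 * A +√-3· - (B₀ * b)) ⊕ cube (+ 9 * C * t +√-3· + 0) ⊗ (+ 9 * A₂ +√-3· - (B₂₀ * b))
    ≡⟨ cong₂ _⊕_ first second ⟩
  (- (+ 9 * B₀ * (b * b * b * b)) + + 6561 * (C * C * C) * (t * t * t * A₂)
    +√-3· - (+ 27 * A * (b * b * b)) - + 729 * (C * C) * b * (C * t * t * t * B₂₀))
    ≡⟨ cong₂ (λ X Y → - (+ 9 * B₀ * (b * b * b * b)) + + 6561 * (C * C * C) * X
                       +√-3· - (+ 27 * A * (b * b * b)) - + 729 * (C * C) * b * Y)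
             t³A₂≡B₀CD² Ct³B₂₀≡AD ⟩
  (- (+ 9 * B₀ * (b * b * b * b)) + + 6561 * (C * C * C) * (B₀ * C * D * D)
    +√-3· - (+ 27 * A * (b * b * b)) - + 729 * (C * C) * b * (A * D))
    ≡⟨ sym (⊗-≡ (b * b + + 27 * C * C * D) (+ 0) (- (+ 9 * B₀ * (b * b - + 27 * C * C * D))) (- (+ 27 * A * b))
                (ℤ-Solver.solve (A ∷ B₀ ∷ b ∷ C ∷ D ∷ [])) (ℤ-Solver.solve (A ∷ B₀ ∷ b ∷ C ∷ D ∷ []))) ⟩
  (b * b + + 27 * C * C * D +√-3· + 0) ⊗ (- (+ 9 * B₀ * (b * b - + 27 * C * C * D)) +√-3· - (+ 27 * A * b))  ∎
  where
  open ≡-Reasoning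
  first : cube (+ 0 +√-3· b) ⊗ (+ 9 * A +√-3· - (B₀ * b)) ≡ (- (+ 9 * B₀ * (b * b * b * b)) +√-3· - (+ 27 * A * (b * b * b)))
  first = trans (cong (_⊗ (+ 9 * A +√-3· - (B₀ * b))) (cube-√-3 b))
                (⊗-≡ (+ 0) (- (+ 3 * (b * b * b))) (+ 9 * A) (- (B₀ * b))
                     (ℤ-Solver.solve (A ∷ B₀ ∷ b ∷ [])) (ℤ-Solver.solve (A ∷ B₀ ∷ b ∷ [])))
  second : cube (+ 9 * C * t +√-3· + 0) ⊗ (+ 9 * A₂ +√-3· - (B₂₀ * b))
         ≡ (+ 6561 * (C * C * C) * (t * t * t * A₂) +√-3· - (+ 729 * (C * C) * b * (C * t * t * t * B₂₀)))
  second = trans (cong (_⊗ (+ 9 * A₂ +√-3· - (B₂₀ * b))) (cube-rational (+ 9 * C * t)))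
                 (⊗-≡ (+ 9 * C * t * (+ 9 * C * t) * (+ 9 * C * t)) (+ 0) (+ 9 * A₂) (- (B₂₀ * b))
                      (ℤ-Solver.solve (A₂ ∷ B₂₀ ∷ b ∷ C ∷ t ∷ [])) (ℤ-Solver.solve (A₂ ∷ B₂₀ ∷ b ∷ C ∷ t ∷ [])))

-- Rarg D A′ B′ b is definitionally Rarg′ A′ (B′ /ℕ' Cof D A′ B′) b.
Rarg′ : ℤ → ℤ → ℤ → ℤω
Rarg′ A′ B″ b = fromℤ (+ 9 * A′) -ω (fromℤ (B″ * b) *ω √-3)

cubic-relation : ∀ A B₀ A₂ B₂₀ b C D t →
  t * t * t * A₂ ≡ B₀ * C * D * D → C * t * t * t * B₂₀ ≡ A * D →
  ((((fromℤ b *ω √-3) ^ω 3) *ω Rarg′ A B₀ b) +ω ((fromℤ (+ 9 * C * t) ^ω 3) *ω Rarg′ A₂ B₂₀ b))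
    ≡ (fromℤ (b * b + + 27 * C * C * D) *ω toℤω (- (+ 9 * B₀ * (b * b - + 27 * C * C * D)) +√-3· - (+ 27 * A * b)))
cubic-relation A B₀ A₂ B₂₀ b C D t t³A₂≡B₀CD² Ct³B₂₀≡AD = begin
  ((((fromℤ b *ω √-3) ^ω 3) *ω Rarg′ A B₀ b) +ω ((fromℤ (+ 9 * C * t) ^ω 3) *ω Rarg′ A₂ B₂₀ b))
    ≡⟨ cong₂ _+ω_ (cong₂ _*ω_ β³≡ (fromℤ-fromℤ*√-3≡toℤω (+ 9 * A) (B₀ * b)))
                  (cong₂ _*ω_ δ³≡ (fromℤ-fromℤ*√-3≡toℤω (+ 9 * A₂) (B₂₀ * b))) ⟩
  ((toℤω β′ *ω toℤω α′) +ω (toℤω δ′ *ω toℤω α₂′))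
    ≡⟨ cong₂ _+ω_ (toℤω-⊗ β′ α′) (toℤω-⊗ δ′ α₂′) ⟨
  (toℤω (β′ ⊗ α′) +ω toℤω (δ′ ⊗ α₂′))
    ≡⟨ toℤω-⊕ (β′ ⊗ α′) (δ′ ⊗ α₂′) ⟨
  toℤω (β′ ⊗ α′ ⊕ δ′ ⊗ α₂′)
    ≡⟨ cong toℤω (cubic-relation-ℤ[√-3] A B₀ A₂ B₂₀ b C D t t³A₂≡B₀CD² Ct³B₂₀≡AD) ⟩
  toℤω ((k +√-3· + 0) ⊗ E)
    ≡⟨ toℤω-⊗ (k +√-3· + 0) E ⟩
  (toℤω (k +√-3· + 0) *ω toℤω E)
    ≡⟨ cong (_*ω toℤω E) (fromℤ≡toℤω k) ⟨
  (fromℤ k *ω toℤω E)  ∎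
  where
  open ≡-Reasoning
  k : ℤ
  k = b * b + + 27 * C * C * D
  E β′ δ′ α′ α₂′ : ℤ[√-3]
  E = - (+ 9 * B₀ * (b * b - + 27 * C * C * D)) +√-3· - (+ 27 * A * b)
  β′ = cube (+ 0 +√-3· b)
  δ′ = cube (+ 9 * C * t +√-3· + 0)
  α′ = + 9 * A +√-3· - (B₀ * b)
  α₂′ = + 9 * A₂ +√-3· - (B₂₀ * b)
  β³≡ : (fromℤ b *ω √-3) ^ω 3 ≡ toℤω β′
  β³≡ = trans (cong (_^ω 3) (fromℤ*√-3≡toℤω b)) (sym (toℤω-cube (+ 0 +√-3· b)))
  δ³≡ : fromℤ (+ 9 * C * t) ^ω 3 ≡ toℤω δ′
  δ³≡ = trans (cong (_^ω 3) (fromℤ≡toℤω (+ 9 * C * t))) (sym (toℤω-cube (+ 9 * C * t +√-3· + 0)))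

-- From u to u₂

∣-normQ : ∀ {p} D A B → p ℕD.∣ ∣ A ∣ → p ℕD.∣ ∣ B ∣ → p ℕD.∣ ∣ normQ D A B ∣
∣-normQ {p} D A B p∣A p∣B = ℤS.∣⇒∣ᵤ {+ p} {normQ D A B} (ℤS.∣m∣n⇒∣m-n {+ p} {A * A} {B * B * + D}
  (ℤS.∣m⇒∣m*n {+ p} {A} A (ℤS.∣ᵤ⇒∣ {+ p} {A} p∣A))
  (ℤS.∣m⇒∣m*n {+ p} {B * B} (+ D) (ℤS.∣m⇒∣m*n {+ p} {B} B (ℤS.∣ᵤ⇒∣ {+ p} {B} p∣B))))

InS⇒≢0 : ∀ {D A B} → InS D A B → ¬ (A ≡ + 0 × B ≡ + 0)
InS⇒≢0 {D} (_ , not-cube , _) (refl , refl) = not-cube (+ 0 , + 0 , 0∈O , refl , refl)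
  where
  0∈O : InO D (+ 0) (+ 0)
  0∈O with D ℕ.% 4 ℕ.≟ 1
  ... | yes D≡1 = inj₁ (D≡1 , ℕD._∣0 2)
  ... | no D≢1 = inj₂ (D≢1 , ℕD._∣0 2 , ℕD._∣0 2)

coprime-to-3ND : ∀ {p} a f N D y → Prime p → ℤgcd (a * f) (+ 3 * N * + D * y) ≡ + 1 → p ℕD.∣ ∣ a ∣ →
  (¬ p ℕD.∣ 3) × (¬ p ℕD.∣ ∣ N ∣) × (¬ p ℕD.∣ D)
coprime-to-3ND {p} a f N D y p-prime gcd≡1 p∣a =
    (λ p∣3 → p∤3NDy (ℕD.∣m⇒∣m*n ∣ y ∣ (ℕD.∣m⇒∣m*n D (ℕD.∣m⇒∣m*n ∣ N ∣ p∣3))))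
  , (λ p∣N → p∤3NDy (ℕD.∣m⇒∣m*n ∣ y ∣ (ℕD.∣m⇒∣m*n D (ℕD.∣n⇒∣m*n 3 p∣N))))
  , (λ p∣D → p∤3NDy (ℕD.∣m⇒∣m*n ∣ y ∣ (ℕD.∣n⇒∣m*n (3 ℕ.* ∣ N ∣) p∣D)))
  where
  ∣3NDy∣ : ∣ + 3 * N * + D * y ∣ ≡ 3 ℕ.* ∣ N ∣ ℕ.* D ℕ.* ∣ y ∣
  ∣3NDy∣ = trans (ℤP.abs-* (+ 3 * N * + D) y) (cong (ℕ._* ∣ y ∣)
             (trans (ℤP.abs-* (+ 3 * N) (+ D)) (cong (ℕ._* D) (ℤP.abs-* (+ 3) N))))
  p∤3NDy : ¬ p ℕD.∣ 3 ℕ.* ∣ N ∣ ℕ.* D ℕ.* ∣ y ∣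
  p∤3NDy p∣3NDy = gcd≡1∧∣m⇒∤n {m = a * f} {n = + 3 * N * + D * y} p-prime gcd≡1
    (subst (p ℕD.∣_) (sym (ℤP.abs-* a f)) (ℕD.∣m⇒∣m*n ∣ f ∣ p∣a)) (subst (p ℕD.∣_) (sym ∣3NDy∣) p∣3NDy)

module _ {D : ℕ} (D≢0 : D ≢ 0) {A B : ℤ} (u∈S : InS D A B) {t : ℕ} {A₂ B₂ : ℤ}
         (BDD≡A₂T : B * + D * + D ≡ A₂ * + (t ℕ.* t ℕ.* t))
         (AD≡B₂T : A * + D ≡ B₂ * + (t ℕ.* t ℕ.* t)) where

  private
    T g g₂ : ℕ
    T = t ℕ.* t ℕ.* t
    g = ℕG.gcd ∣ A ∣ ∣ B ∣
    g₂ = ℕG.gcd ∣ A₂ ∣ ∣ B₂ ∣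
    instance
      D-nonZero : ℕ.NonZero D
      D-nonZero = ℕ.≢-nonZero D≢0

  ∣B∣DD≡∣A₂∣T : ∣ B ∣ ℕ.* D ℕ.* D ≡ ∣ A₂ ∣ ℕ.* T
  ∣B∣DD≡∣A₂∣T = trans (sym (trans (ℤP.abs-* (B * + D) (+ D)) (cong (ℕ._* D) (ℤP.abs-* B (+ D)))))
                      (trans (cong ∣_∣ BDD≡A₂T) (ℤP.abs-* A₂ (+ T)))

  ∣A∣D≡∣B₂∣T : ∣ A ∣ ℕ.* D ≡ ∣ B₂ ∣ ℕ.* T
  ∣A∣D≡∣B₂∣T = trans (sym (ℤP.abs-* A (+ D))) (trans (cong ∣_∣ AD≡B₂T) (ℤP.abs-* B₂ (+ T)))

  p∤D⇒p∤t : ∀ {p} → Prime p → ¬ p ℕD.∣ D → ¬ p ℕD.∣ t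
  p∤D⇒p∤t {p} p-prime p∤D p∣t = proj₂ (proj₂ u∈S) p p-prime (ℕG.gcd-greatest {∣ A ∣} {∣ B ∣} p³∣∣A∣ p³∣∣B∣)
    where
    p³∣T : p ℕ.^ 3 ℕD.∣ T
    p³∣T = subst (ℕD._∣ T) (cube≡^3 p) (ℕD.*-pres-∣ (ℕD.*-pres-∣ p∣t p∣t) p∣t)
    p³∣∣A∣ : p ℕ.* p ℕ.* p ℕD.∣ ∣ A ∣
    p³∣∣A∣ = subst (ℕD._∣ ∣ A ∣) (sym (cube≡^3 p)) (prime^k∣m*n⇒∣m p-prime p∤D 3
               (subst (p ℕ.^ 3 ℕD.∣_) (sym ∣A∣D≡∣B₂∣T) (ℕD.∣n⇒∣m*n ∣ B₂ ∣ p³∣T)))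
    p³∣∣B∣ : p ℕ.* p ℕ.* p ℕD.∣ ∣ B ∣
    p³∣∣B∣ = subst (ℕD._∣ ∣ B ∣) (sym (cube≡^3 p)) (prime^k∣m*n⇒∣m p-prime p∤D 3 (prime^k∣m*n⇒∣m p-prime p∤D 3
               (subst (p ℕ.^ 3 ℕD.∣_) (sym ∣B∣DD≡∣A₂∣T) (ℕD.∣n⇒∣m*n ∣ A₂ ∣ p³∣T))))

  p∤D⇒p∤T : ∀ {p} → Prime p → ¬ p ℕD.∣ D → ¬ p ℕD.∣ T
  p∤D⇒p∤T {p} p-prime p∤D = prime∤m∤n⇒∤m*n p-prime (prime∤m∤n⇒∤m*n p-prime p∤t p∤t) p∤t
    where
    p∤t : ¬ p ℕD.∣ t
    p∤t = p∤D⇒p∤t p-prime p∤D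

  gcd≢0 : g ≢ 0
  gcd≢0 g≡0 = InS⇒≢0 u∈S (ℤP.∣i∣≡0⇒i≡0 (ℕG.gcd[m,n]≡0⇒m≡0 {∣ A ∣} g≡0) , ℤP.∣i∣≡0⇒i≡0 (ℕG.gcd[m,n]≡0⇒n≡0 ∣ A ∣ g≡0))

  gcd₂≢0 : g₂ ≢ 0
  gcd₂≢0 g₂≡0 = InS⇒≢0 u∈S (ℤP.∣i∣≡0⇒i≡0 ∣A∣≡0 , ℤP.∣i∣≡0⇒i≡0 ∣B∣≡0)
    where
    ∣A∣≡0 : ∣ A ∣ ≡ 0
    ∣A∣≡0 = ℕP.m*n≡0⇒m≡0 ∣ A ∣ D (trans ∣A∣D≡∣B₂∣T (cong (ℕ._* T) (ℕG.gcd[m,n]≡0⇒n≡0 ∣ A₂ ∣ g₂≡0)))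
    ∣B∣≡0 : ∣ B ∣ ≡ 0
    ∣B∣≡0 = ℕP.m*n≡0⇒m≡0 ∣ B ∣ D (ℕP.m*n≡0⇒m≡0 (∣ B ∣ ℕ.* D) D
              (trans ∣B∣DD≡∣A₂∣T (cong (ℕ._* T) (ℕG.gcd[m,n]≡0⇒m≡0 {∣ A₂ ∣} g₂≡0))))

  Cof-u₂≡Cof-u : Cof D A₂ B₂ ≡ Cof D A B
  Cof-u₂≡Cof-u = Cofℕ-cong D g₂ g gcd₂≢0 gcd≢0 same-primes
    where
    same-primes : ∀ p → Prime p → ¬ p ℕD.∣ D → (p ℕD.∣ g₂ → p ℕD.∣ g) × (p ℕD.∣ g → p ℕD.∣ g₂)
    same-primes p p-prime p∤D = to , from
      where
      to : p ℕD.∣ g₂ → p ℕD.∣ g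
      to p∣g₂ = ℕG.gcd-greatest {∣ A ∣} {∣ B ∣}
        (prime∣m*n∤n⇒∣m p-prime p∤D (subst (p ℕD.∣_) (sym ∣A∣D≡∣B₂∣T)
          (ℕD.∣m⇒∣m*n T (ℕD.∣-trans p∣g₂ (ℕG.gcd[m,n]∣n ∣ A₂ ∣ ∣ B₂ ∣)))))
        (prime∣m*n∤n⇒∣m p-prime p∤D (prime∣m*n∤n⇒∣m p-prime p∤D (subst (p ℕD.∣_) (sym ∣B∣DD≡∣A₂∣T)
          (ℕD.∣m⇒∣m*n T (ℕD.∣-trans p∣g₂ (ℕG.gcd[m,n]∣m ∣ A₂ ∣ ∣ B₂ ∣))))))
      from : p ℕD.∣ g → p ℕD.∣ g₂
      from p∣g = ℕG.gcd-greatest {∣ A₂ ∣} {∣ B₂ ∣}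
        (prime∣m*n∤n⇒∣m p-prime (p∤D⇒p∤T p-prime p∤D) (subst (p ℕD.∣_) ∣B∣DD≡∣A₂∣T
          (ℕD.∣m⇒∣m*n D (ℕD.∣m⇒∣m*n D (ℕD.∣-trans p∣g (ℕG.gcd[m,n]∣n ∣ A ∣ ∣ B ∣))))))
        (prime∣m*n∤n⇒∣m p-prime (p∤D⇒p∤T p-prime p∤D) (subst (p ℕD.∣_) ∣A∣D≡∣B₂∣T
          (ℕD.∣m⇒∣m*n D (ℕD.∣-trans p∣g (ℕG.gcd[m,n]∣m ∣ A ∣ ∣ B ∣)))))

  module _ {a b c : ℤ} (0<a : + 0 < a)
           (disc : b * b - a * c ≡ - (+ 27 * + Cof D A B * + Cof D A B * + D))
           (a⊥3ND : ∀ {p} → Prime p → p ℕD.∣ ∣ a ∣ → (¬ p ℕD.∣ 3) × (¬ p ℕD.∣ ∣ normQ D A B ∣) × (¬ p ℕD.∣ D)) where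

    private
      C : ℕ
      C = Cof D A B
      B₀ B₂₀ : ℤ
      B₀ = B /ℕ' C
      B₂₀ = B₂ /ℕ' Cof D A₂ B₂
      β δ : ℤω
      β = fromℤ b *ω √-3
      δ = fromℤ (+ 9 * + C * + t)
      E : ℤω
      E = toℤω (- (+ 9 * B₀ * (b * b - + 27 * + C * + C * + D)) +√-3· - (+ 27 * A * b))

    C∣∣A∣ : C ℕD.∣ ∣ A ∣
    C∣∣A∣ = ℕD.∣-trans (Cofℕ∣ D g) (ℕG.gcd[m,n]∣m ∣ A ∣ ∣ B ∣)

    C∣∣B∣ : C ℕD.∣ ∣ B ∣
    C∣∣B∣ = ℕD.∣-trans (Cofℕ∣ D g) (ℕG.gcd[m,n]∣n ∣ A ∣ ∣ B ∣)

    B≡B₀C : B ≡ B₀ * + C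
    B≡B₀C = /ℕ'-exact B C (Cofℕ≢0 D g) C∣∣B∣

    B₂≡B₂₀C : B₂ ≡ B₂₀ * + C
    B₂≡B₂₀C = trans (/ℕ'-exact B₂ (Cof D A₂ B₂) (Cofℕ≢0 D g₂) (ℕD.∣-trans (Cofℕ∣ D g₂) (ℕG.gcd[m,n]∣n ∣ A₂ ∣ ∣ B₂ ∣)))
                    (cong (λ k → B₂₀ * + k) Cof-u₂≡Cof-u)

    ∣27CCD∣ : ∣ + 27 * + C * + C * + D ∣ ≡ 27 ℕ.* C ℕ.* C ℕ.* D
    ∣27CCD∣ = trans (ℤP.abs-* (+ 27 * + C * + C) (+ D)) (cong (ℕ._* D)
                (trans (ℤP.abs-* (+ 27 * + C) (+ C)) (cong (ℕ._* C) (ℤP.abs-* (+ 27) (+ C)))))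

    ∣9Ct∣ : ∣ + 9 * + C * + t ∣ ≡ 9 ℕ.* C ℕ.* t
    ∣9Ct∣ = trans (ℤP.abs-* (+ 9 * + C) (+ t)) (cong (ℕ._* t) (ℤP.abs-* (+ 9) (+ C)))

    +T≡t*t*t : + T ≡ + t * + t * + t
    +T≡t*t*t = trans (ℤP.pos-* (t ℕ.* t) t) (cong (_* + t) (ℤP.pos-* t t))

    t³A₂≡B₀CD² : + t * + t * + t * A₂ ≡ B₀ * + C * + D * + D
    t³A₂≡B₀CD² = begin
      + t * + t * + t * A₂   ≡⟨ ℤP.*-comm (+ t * + t * + t) A₂ ⟩
      A₂ * (+ t * + t * + t) ≡⟨ cong (A₂ *_) +T≡t*t*t ⟨
      A₂ * + T               ≡⟨ BDD≡A₂T ⟨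
      B * + D * + D          ≡⟨ cong (λ z → z * + D * + D) B≡B₀C ⟩
      B₀ * + C * + D * + D   ∎
      where open ≡-Reasoning

    Ct³B₂₀≡AD : + C * + t * + t * + t * B₂₀ ≡ A * + D
    Ct³B₂₀≡AD = begin
      + C * + t * + t * + t * B₂₀  ≡⟨ rearrange (+ C) (+ t) B₂₀ ⟩
      B₂₀ * + C * (+ t * + t * + t) ≡⟨ cong₂ _*_ B₂≡B₂₀C +T≡t*t*t ⟨
      B₂ * + T                     ≡⟨ AD≡B₂T ⟨
      A * + D                      ∎
      where
      open ≡-Reasoning
      rearrange : ∀ C t B₂₀ → C * t * t * t * B₂₀ ≡ B₂₀ * C * (t * t * t)
      rearrange = ℤ-Solver.solve-∀

    cubic-congruence : ((β ^ω 3) *ω Rarg D A B b) ≈ ((negω δ ^ω 3) *ω Rarg D A₂ B₂ b) mod fromℤ a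
    cubic-congruence = ∣⇒≈ (fromℤ c *ω E , (begin
      (((β ^ω 3) *ω Rarg D A B b) -ω ((negω δ ^ω 3) *ω Rarg D A₂ B₂ b))
        ≡⟨ x-[-y]³z≡x+y³z ((β ^ω 3) *ω Rarg D A B b) δ (Rarg D A₂ B₂ b) ⟩
      (((β ^ω 3) *ω Rarg D A B b) +ω ((δ ^ω 3) *ω Rarg D A₂ B₂ b))
        ≡⟨ cubic-relation A B₀ A₂ B₂₀ b (+ C) (+ D) (+ t) t³A₂≡B₀CD² Ct³B₂₀≡AD ⟩
      (fromℤ (b * b + + 27 * + C * + C * + D) *ω E)
        ≡⟨ cong (λ k → fromℤ k *ω E) (x-y≡-z⇒x+z≡y (b * b) (a * c) disc) ⟩
      (fromℤ (a * c) *ω E)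
        ≡⟨ cong (_*ω E) (fromℤ-* a c) ⟩
      ((fromℤ a *ω fromℤ c) *ω E)
        ≡⟨ *ω-assoc (fromℤ a) (fromℤ c) E ⟩
      (fromℤ a *ω (fromℤ c *ω E))     ∎))
      where
      open ≡-Reasoning
      x-[-y]³z≡x+y³z : ∀ x y z → (x +ω negω ((negω y *ω (negω y *ω (negω y *ω oneω))) *ω z))
                                ≡ (x +ω ((y *ω (y *ω (y *ω oneω))) *ω z))
      x-[-y]³z≡x+y³z = solve-∀ ℤω-ring

    p∣a⇒p∤C : ∀ {p} → Prime p → p ℕD.∣ ∣ a ∣ → ¬ p ℕD.∣ C
    p∣a⇒p∤C p-prime p∣a p∣C =
      proj₁ (proj₂ (a⊥3ND p-prime p∣a)) (∣-normQ D A B (ℕD.∣-trans p∣C C∣∣A∣) (ℕD.∣-trans p∣C C∣∣B∣))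

    p∣a⇒p∤9 : ∀ {p} → Prime p → p ℕD.∣ ∣ a ∣ → ¬ p ℕD.∣ 9
    p∣a⇒p∤9 p-prime p∣a = prime∤m∤n⇒∤m*n p-prime (proj₁ (a⊥3ND p-prime p∣a)) (proj₁ (a⊥3ND p-prime p∣a))

    p∣a⇒p∤b : ∀ {p} → Prime p → p ℕD.∣ ∣ a ∣ → ¬ p ℕD.∣ ∣ b ∣
    p∣a⇒p∤b {p} p-prime p∣a p∣b = p∤27CCD (subst (p ℕD.∣_) (trans (ℤP.∣-i∣≡∣i∣ (+ 27 * + C * + C * + D)) ∣27CCD∣)
      (subst (λ z → p ℕD.∣ ∣ z ∣) disc (ℤS.∣⇒∣ᵤ {+ p} {b * b - a * c} (ℤS.∣m∣n⇒∣m-n {+ p} {b * b} {a * c}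
        (ℤS.∣m⇒∣m*n {+ p} {b} b (ℤS.∣ᵤ⇒∣ {+ p} {b} p∣b)) (ℤS.∣m⇒∣m*n {+ p} {a} c (ℤS.∣ᵤ⇒∣ {+ p} {a} p∣a))))))
      where
      p∤27CCD : ¬ p ℕD.∣ 27 ℕ.* C ℕ.* C ℕ.* D
      p∤27CCD = prime∤m∤n⇒∤m*n p-prime (prime∤m∤n⇒∤m*n p-prime (prime∤m∤n⇒∤m*n p-prime
                  (prime∤m∤n⇒∤m*n p-prime (proj₁ (a⊥3ND p-prime p∣a)) (p∣a⇒p∤9 p-prime p∣a))
                  (p∣a⇒p∤C p-prime p∣a)) (p∣a⇒p∤C p-prime p∣a)) (proj₂ (proj₂ (a⊥3ND p-prime p∣a)))

    p∣a⇒p∤9Ct : ∀ {p} → Prime p → p ℕD.∣ ∣ a ∣ → ¬ p ℕD.∣ ∣ + 9 * + C * + t ∣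
    p∣a⇒p∤9Ct {p} p-prime p∣a = subst (λ n → ¬ p ℕD.∣ n) (sym ∣9Ct∣)
      (prime∤m∤n⇒∤m*n p-prime (prime∤m∤n⇒∤m*n p-prime (p∣a⇒p∤9 p-prime p∣a) (p∣a⇒p∤C p-prime p∣a))
                              (p∤D⇒p∤t p-prime (proj₂ (proj₂ (a⊥3ND p-prime p∣a)))))

    R-local-transfer-over : ∀ {π p} → Primeω π → Prime p → π ∣ω fromℤ (+ p) → ¬ π ∣ω fromℤ (+ 3) →
      π ∣ω fromℤ a → ∀ ζ →
      (CubicSymP (Rarg D A B b) π ζ → CubicSymP (Rarg D A₂ B₂ b) π ζ) ×
      (CubicSymP (Rarg D A₂ B₂ b) π ζ → CubicSymP (Rarg D A B b) π ζ)
    R-local-transfer-over {π} {p} π-prime p-prime π∣p π∤3 π∣a ζ =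
        CubicSymP-transfer π-prime p-prime π∣p π∤3 π∤β π∤-δ congruence ζ
      , CubicSymP-transfer π-prime p-prime π∣p π∤3 π∤-δ π∤β (≈-sym congruence) ζ
      where
      p∣a : p ℕD.∣ ∣ a ∣
      p∣a = ∣ω-fromℤ⇒∣ π-prime p-prime π∣p π∣a
      -- π ∣ √-3 would give π ∣ −(√-3)² = 3, and negω (√-3 *ω √-3) computes to fromℤ (+ 3).
      π∤β : ¬ π ∣ω β
      π∤β π∣β = [ (λ π∣b → p∣a⇒p∤b p-prime p∣a (∣ω-fromℤ⇒∣ π-prime p-prime π∣p π∣b))
                , (λ π∣√-3 → π∤3 (∣ω-negω {π} (∣ω-*ʳ {π} √-3 π∣√-3))) ]′
                (proj₂ (proj₂ π-prime) (fromℤ b) √-3 π∣β)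
      π∤-δ : ¬ π ∣ω negω δ
      π∤-δ π∣-δ = p∣a⇒p∤9Ct p-prime p∣a
        (∣ω-fromℤ⇒∣ π-prime p-prime π∣p (subst (π ∣ω_) (negω-involutive δ) (∣ω-negω {π} π∣-δ)))
      congruence : ((β ^ω 3) *ω Rarg D A B b) ≈ ((negω δ ^ω 3) *ω Rarg D A₂ B₂ b) mod π
      congruence = ≈-mod-∣ {π} π∣a cubic-congruence

    R-local-transfer : ∀ {π} → Primeω π → ¬ π ∣ω fromℤ (+ 3) → π ∣ω fromℤ (+ ∣ a ∣) → ∀ ζ →
      (CubicSymP (Rarg D A B b) π ζ → CubicSymP (Rarg D A₂ B₂ b) π ζ) ×
      (CubicSymP (Rarg D A₂ B₂ b) π ζ → CubicSymP (Rarg D A B b) π ζ)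
    R-local-transfer {π} π-prime π∤3 π∣∣a∣ =
      let p , p-prime , π∣p = prime-below π-prime ∣ a ∣ ⦃ 0<i⇒∣i∣-nonZero 0<a ⦄ π∣∣a∣
      in  R-local-transfer-over π-prime p-prime π∣p π∤3
            (subst (λ z → π ∣ω fromℤ z) (ℤP.0≤i⇒+∣i∣≡i (ℤP.<⇒≤ 0<a)) π∣∣a∣)

lemma2p2 : (D : ℕ) → 1 ℕ.< D → Squarefree D →
    (A B : ℤ) → InS D A B →
    (a b c : ℤ) → + 0 < a →
    (∀ (p : ℕ) → Prime p → ¬ (((+ p) ∣ a) × ((+ p) ∣ (+ 2 * b)) × ((+ p) ∣ c))) →
    b * b - a * c ≡ ℤ.- (+ 27 * + (Cof D A B) * + (Cof D A B) * + D) →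
    (x y : ℤ) →
    ℤgcd (a * (a * x * x + + 2 * b * x * y + c * y * y)) (+ 3 * normQ D A B * + D * y) ≡ + 1 →
    (t : ℕ) → LargestCube (B * + D * + D) (A * + D) t →
    (A₂' B₂' : ℤ) →
    B * + D * + D ≡ A₂' * + (t ℕ.* t ℕ.* t) →
    A * + D ≡ B₂' * + (t ℕ.* t ℕ.* t) →
    (ζ : Cub) →
    (R D A B b (ℤ.∣ a ∣) ζ → R D A₂' B₂' b (ℤ.∣ a ∣) ζ) × (R D A₂' B₂' b (ℤ.∣ a ∣) ζ → R D A B b (ℤ.∣ a ∣) ζ)
lemma2p2 D 1<D _ A B u∈S a b c 0<a _ disc x y gcd≡1 t _ A₂ B₂ BDD≡A₂T AD≡B₂T ζ =
    CubicSym-transfer (λ π-prime π∤3 π∣a ζ′ → proj₁ (local π-prime π∤3 π∣a ζ′))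
  , CubicSym-transfer (λ π-prime π∤3 π∣a ζ′ → proj₂ (local π-prime π∤3 π∣a ζ′))
  where
  D≢0 : ¬ D ≡ 0
  D≢0 refl = ℕP.n≮0 1<D
  local : ∀ {π} → Primeω π → ¬ π ∣ω fromℤ (+ 3) → π ∣ω fromℤ (+ ℤ.∣ a ∣) → ∀ ζ →
          (CubicSymP (Rarg D A B b) π ζ → CubicSymP (Rarg D A₂ B₂ b) π ζ) ×
          (CubicSymP (Rarg D A₂ B₂ b) π ζ → CubicSymP (Rarg D A B b) π ζ)
  local = R-local-transfer D≢0 {A} {B} u∈S {t} {A₂} {B₂} BDD≡A₂T AD≡B₂T {a} {b} {c} 0<a disc
            (λ p-prime → coprime-to-3ND a (a * x * x + + 2 * b * x * y + c * y * y) (normQ D A B) D y p-prime gcd≡1)
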